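{- Let $(G,T)$ be a bipartite graft with color classes $A$ and $B$, let $F$ be a minimum join of $(G,T)$, and let $X\subseteq A$ be a maximal bipartitic extreme set. Let $C'\subseteq C_X$, and let $G':=G-C'$ and $T':=T\setminus C'$. Then: (i) a set of edges is a minimum join of $(G',T')$ if and only if it is a minimum join of $(G,T)$; (ii) for every $y\in D_X$, $\min_{x\in X}\lambda_{(G',T'),F}(x,y)=\min_{x\in X}\lambda_{(G,T),F}(x,y)$; (iii) for every $x\in X$ and every $y\in C_X\setminus C'$, $\lambda_{(G',T'),F}(x,y)>0$; (iv) for every $x,y\in X$, $\lambda_{(G',T'),F}(x,y)\ge 0$; (v) $X$ is a maximal bipartitic extreme set of $(G',T')$.
   Context: All graphs are finite (parallel edges allowed). A graft is a pair $(G,T)$ with $T\subseteq V(G)$; a join is $F\subseteq E(G)$ such that each vertex is incident to an odd number of edges of $F$ iff it lies in $T$; a minimum join is one of minimum size. A bipartite graft has $G$ bipartite with given color classes (subgraphs inherit the coloring). For $F\subseteq E$ and a subgraph $Q$, $w_F(Q)=|E(Q)\setminus F|-|E(Q)\cap F|$; $\lambda_{(G,T),F}(x,y)$ is the minimum of $w_F(P)$ over paths $P$ of $G$ between $x$ and $y$ ($0$ if $x=y$); for a minimum join $F$ it does not depend on the choice of $F$. A set $X$ is extreme in $(G,T)$ if $\lambda_{(G,T),F}(x,y)\ge0$ for all $x,y\in X$ ($F$ a minimum join). An extreme set is bipartitic if contained in one color class; maximal bipartitic extreme means not properly contained in another bipartitic extreme set. $D_X:=\{y\in V(G)\setminus X:\min_{x\in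 X}\lambda_{(G,T),F}(x,y)<0\}$ and $C_X:=V(G)\setminus X\setminus D_X$ (computed in $(G,T)$). -}

module Defs where

open import Data.Nat as ℕ using (ℕ; _%_)
open import Data.Integer as ℤ using (ℤ; +_; -[1+_])
open import Data.Bool using (Bool; true; false; not; _∧_; if_then_else_)
open import Data.Fin using (Fin)
open import Data.Fin.Subset using (Subset; _∈_; _∉_; _⊆_; ∁; _─_; ∣_∣)
open import Data.Vec using (lookup; tabulate)
open import Data.List using (List; []; _∷_; map; allFin)
open import Data.Nat.ListAction using (sum)
open import Data.List.Relation.Unary.All using (All)
open import Data.List.Relation.Unary.Unique.Propositional using (Unique)
open import Data.Product using (_×_; _,_; proj₁; proj₂; ∃; Σ-syntax)
open import Data.Sum using (_⊎_)
open import Relation.Binary.PropositionalEquality using (_≡_; _≢_)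
open import Relation.Nullary using (¬_)
open import Function.Bundles using (_⇔_)
open import Relation.Nullary.Decidable using (⌊_⌋)
open import Data.Fin using (_≟_)

-- extended integers (minimum over an empty set of paths is +∞)

data ℤ∞ : Set where
  fin : ℤ → ℤ∞
  ∞   : ℤ∞

data _≤∞_ : ℤ∞ → ℤ∞ → Set where
  fin≤fin : ∀ {a b} → a ℤ.≤ b → fin a ≤∞ fin b
  _≤∞∞    : ∀ a → a ≤∞ ∞

_<∞_ : ℤ∞ → ℤ∞ → Set
a <∞ b = a ≤∞ b × a ≢ b


-- Ambient multigraph: vertices Fin n, edges Fin m, each edge has two
-- endpoints (parallel edges allowed).

record Multigraph (n m : ℕ) : Set where
  field ends : Fin m → Fin n × Fin n

module _ {n m : ℕ} (M : Multigraph n m) where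
  open Multigraph M

  record SubG : Set where
    field
      V : Subset n
      E : Subset m
  open SubG public

  whole : SubG
  whole = record { V = Data.Fin.Subset.⊤ ; E = Data.Fin.Subset.⊤ }

  delete : SubG → Subset n → SubG
  delete S C = record
    { V = V S ─ C
    ; E = tabulate (λ e → lookup (E S) e
                          ∧ not (lookup C (proj₁ (ends e)))
                          ∧ not (lookup C (proj₂ (ends e)))) }

  WellFormed : SubG → Set
  WellFormed S = ∀ e → e ∈ E S → proj₁ (ends e) ∈ V S × proj₂ (ends e) ∈ V S

  -- bipartite with respect to the given coloring col (color classes
  -- A = {v | col v ≡ true}, B = {v | col v ≡ false})
  Bipartite : (Fin n → Bool) → SubG → Set
  Bipartite col S = ∀ e → e ∈ E S → col (proj₁ (ends e)) ≢ col (proj₂ (ends e))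

  ind : Bool → ℕ
  ind true  = 1
  ind false = 0

  eqb : Fin n → Fin n → Bool
  eqb u v = ⌊ u ≟ v ⌋

  -- number of edges of F incident to v (a loop counted twice)
  deg : Subset m → Fin n → ℕ
  deg F v = sum (map (λ e → ind (lookup F e) ℕ.*
                              (ind (eqb (proj₁ (ends e)) v) ℕ.+ ind (eqb (proj₂ (ends e)) v)))
                     (allFin m))

  IsJoin : SubG → Subset n → Subset m → Set
  IsJoin S T F = F ⊆ E S × (∀ v → v ∈ V S → ((deg F v % 2 ≡ 1) ⇔ v ∈ T))

  IsMinJoin : SubG → Subset n → Subset m → Set
  IsMinJoin S T F = IsJoin S T F × (∀ F′ → IsJoin S T F′ → ∣ F ∣ ℕ.≤ ∣ F′ ∣)

  Joins : Fin m → Fin n → Fin n → Set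
  Joins e x y = ends e ≡ (x , y) ⊎ ends e ≡ (y , x)

  data Walk (S : SubG) : Fin n → Fin n → Set where
    nil  : ∀ x → Walk S x x
    cons : ∀ {x y z} (e : Fin m) → e ∈ E S → Joins e x y → Walk S y z → Walk S x z

  verts : ∀ {S x y} → Walk S x y → List (Fin n)
  verts (nil x) = x ∷ []
  verts (cons {x = x} e _ _ w) = x ∷ verts w

  edgesOf : ∀ {S x y} → Walk S x y → List (Fin m)
  edgesOf (nil x) = []
  edgesOf (cons e _ _ w) = e ∷ edgesOf w

  IsPath : ∀ {S x y} → Walk S x y → Set
  IsPath {S} w = All (_∈ V S) (verts w) × Unique (verts w)

  -- w_F(P) = |E(P) \ F| - |E(P) ∩ F|  (edges of a path are distinct)
  wt : Subset m → List (Fin m) → ℤ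
  wt F [] = + 0
  wt F (e ∷ es) = (if lookup F e then -[1+ 0 ] else + 1) ℤ.+ wt F es

  weight : ∀ {S x y} → Subset m → Walk S x y → ℤ
  weight F w = wt F (edgesOf w)

  -- Lam S F x y k : k = λ_{S,F}(x,y), the minimum of w_F(P) over paths
  -- P of S between x and y (+∞ if there is none).  For x = y the only
  -- path is the trivial one, so the value is 0.
  Lam : SubG → Subset m → Fin n → Fin n → ℤ∞ → Set
  Lam S F x y (fin k) =
    (Σ[ P ∈ Walk S x y ] IsPath P × weight F P ≡ k)
    × (∀ (P : Walk S x y) → IsPath P → k ℤ.≤ weight F P)
  Lam S F x y ∞ = ∀ (P : Walk S x y) → ¬ IsPath P

  MinLam : SubG → Subset m → Subset n → Fin n → ℤ∞ → Set
  MinLam S F X y k =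
    (∃ λ x → x ∈ X × Lam S F x y k)
    × (∀ x k′ → x ∈ X → Lam S F x y k′ → k ≤∞ k′)

  -- extreme sets (F is meant to be a minimum join of (S,T))

  Extreme : SubG → Subset m → Subset n → Set
  Extreme S F X = X ⊆ V S × (∀ x y k → x ∈ X → y ∈ X → Lam S F x y k → fin (+ 0) ≤∞ k)

  InClass : (Fin n → Bool) → SubG → Bool → Subset n → Set
  InClass col S b X = ∀ v → v ∈ X → v ∈ V S × col v ≡ b

  BipExtreme : (Fin n → Bool) → SubG → Subset m → Subset n → Set
  BipExtreme col S F X = Extreme S F X × (InClass col S true X ⊎ InClass col S false X)

  MaxBipExtreme : (Fin n → Bool) → SubG → Subset m → Subset n → Set
  MaxBipExtreme col S F X =
    BipExtreme col S F X × (∀ Y → BipExtreme col S F Y → X ⊆ Y → Y ⊆ X)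

  InD : SubG → Subset m → Subset n → Fin n → Set
  InD S F X y = y ∈ V S × y ∉ X × ∃ λ k → MinLam S F X y k × k <∞ fin (+ 0)

  InC : SubG → Subset m → Subset n → Fin n → Set
  InC S F X y = y ∈ V S × y ∉ X × ¬ InD S F X y

{-# OPTIONS --safe #-}
-- For a path P, w_F(P) = |P| − 2|P ∩ F|. Since F is a minimum join, F ⊕ E is again a join for
-- every even edge set E, so no even set has more than half of its edges in F. Applied to a path
-- closed by one edge, and to F ⊕ F₂ for another minimum join F₂, this gives: a path between the
-- ends of an edge has weight at least −1, and an edge of F₂ − F lies on a negative path between
-- its ends. Maximality of X makes every vertex of A − X the end of a negative path from X, which
-- forces C_X ⊆ B; with the parity of weights in a bipartite graft it also puts every neighbour
-- of C_X into X and keeps every edge at C_X out of every minimum join. So G and G − C′ have the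
-- same minimum joins, and a minimum-weight path from X to a vertex outside C′ never enters C′:
-- leaving a vertex of C_X costs an edge of weight +1 towards X after a non-negative prefix. The
-- remaining statements compare paths of G − C′ with the same paths in G.

module Submission where

open import Defs
open import Data.Nat using (ℕ)
open import Data.Integer using (+_)
open import Data.Bool using (Bool; true)
open import Data.Fin using (Fin)
open import Data.Fin.Subset using (Subset; _∈_; _∉_; _─_)
open import Data.Product using (_×_)
open import Function.Bundles using (_⇔_)

open import Data.Fin.Subset as Sub using (∣_∣; ⊤; _∪_; ⁅_⁆)
import Data.Fin.Subset.Properties as SubsetP
open import Data.Product using (_,_; proj₁; proj₂; ∃; Σ-syntax)
open import Data.Sum as Sum using (_⊎_; inj₁; inj₂)
open import Data.Empty using (⊥; ⊥-elim)
open import Function using (_∘_; case_of_)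
open import Function.Bundles using (mk⇔; Equivalence)
open import Function.Construct.Composition using (_⇔-∘_)
open import Function.Construct.Symmetry using (⇔-sym)
open import Relation.Binary.PropositionalEquality
open import Relation.Nullary using (¬_; Dec; yes; no; does)
open import Relation.Nullary.Decidable
  using (isYes≗does; dec-true; dec-false; ¬¬-excluded-middle; decidable-stable)

open import Data.Bool using (false; not; _∧_; _∨_; _xor_; if_then_else_)
import Data.Bool.Properties as BoolP
open import Data.Nat as ℕ using (zero; suc; _≤_; _<_; z≤n; s≤s; _%_)
import Data.Nat.Properties as ℕP
open import Data.Nat.DivMod using ([m+n]%n≡m%n)
import Data.Nat.ListAction as ListAction
open import Algebra.Properties.CommutativeSemigroup ℕP.+-commutativeSemigroup
  using () renaming (interchange to +-interchange)
open import Algebra.Properties.CommutativeMonoid.Sum ℕP.+-0-commutativeMonoid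
  using (sum-cong-≗; ∑-distrib-+; sum-replicate-zero) renaming (sum to ∑)
open import Data.Integer as ℤ using (ℤ; -[1+_]; _⊖_)
import Data.Integer.Properties as ℤP
open import Data.Fin using (zero; suc; _≟_)
open import Data.Vec as Vec using (lookup)
import Data.Vec.Properties as VecP
open import Data.List as List using (List; []; _∷_; _++_)
import Data.List.Properties as ListP
open import Data.List.Membership.Propositional using () renaming (_∈_ to _∈ₗ_; _∉_ to _∉ₗ_)
import Data.List.Membership.Propositional.Properties as ∈ₗP
open import Data.List.Relation.Unary.Any using (here; there)
open import Data.List.Relation.Unary.All as All using (All; []; _∷_)
import Data.List.Relation.Unary.All.Properties as AllP
open import Data.List.Relation.Unary.AllPairs using ([]; _∷_)
open import Data.List.Relation.Unary.Unique.Propositional using (Unique)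

does-true⇒ : ∀ {A : Set} (a? : Dec A) → does a? ≡ true → A
does-true⇒ (yes a) _ = a
does-true⇒ (no _) ()

𝟙 : Bool → ℕ
𝟙 true = 1
𝟙 false = 0

𝟙≤1 : ∀ b → 𝟙 b ≤ 1
𝟙≤1 true = s≤s z≤n
𝟙≤1 false = z≤n

xor-cancel-middle : ∀ a b c → (a xor b) xor (b xor c) ≡ a xor c
xor-cancel-middle true true c = refl
xor-cancel-middle true false c = refl
xor-cancel-middle false true c = BoolP.not-involutive c
xor-cancel-middle false false c = refl

xor-cancel-left : ∀ a b c → (a xor b) xor (a xor c) ≡ c xor b
xor-cancel-left true b c = not-xor-not b c
  where
  not-xor-not : ∀ b c → not b xor not c ≡ c xor b
  not-xor-not true true = refl
  not-xor-not true false = refl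
  not-xor-not false true = refl
  not-xor-not false false = refl
xor-cancel-left false b c = BoolP.xor-comm b c

xor≡self⇒false : ∀ {a b} → a xor b ≡ b → a ≡ false
xor≡self⇒false {true} {true} ()
xor≡self⇒false {true} {false} ()
xor≡self⇒false {false} _ = refl

xor≡false⇒≡ : ∀ a b → a xor b ≡ false → a ≡ b
xor≡false⇒≡ true true _ = refl
xor≡false⇒≡ false false _ = refl

≡true⇔⇒≡ : ∀ {a b} → (a ≡ true ⇔ b ≡ true) → a ≡ b
≡true⇔⇒≡ {true} a⇔b = sym (Equivalence.to a⇔b refl)
≡true⇔⇒≡ {false} {false} a⇔b = refl
≡true⇔⇒≡ {false} {true} a⇔b = Equivalence.from a⇔b refl

-- Defs compares with ⌊_⌋; does makes suc i =ᵇ suc j reduce to i =ᵇ j.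
_=ᵇ_ : ∀ {k} → Fin k → Fin k → Bool
i =ᵇ j = does (i ≟ j)

=ᵇ-refl : ∀ {k} (i : Fin k) → (i =ᵇ i) ≡ true
=ᵇ-refl i = dec-true (i ≟ i) refl

lookup≡false⇒∉ : ∀ {k} {x : Fin k} {p : Subset k} → lookup p x ≡ false → x ∉ p
lookup≡false⇒∉ eq x∈ = case trans (sym (VecP.[]=⇒lookup x∈)) eq of λ ()

∉⇒lookup≡false : ∀ {k} {x : Fin k} {p : Subset k} → x ∉ p → lookup p x ≡ false
∉⇒lookup≡false {x = x} {p} x∉ with lookup p x in eq
... | true = ⊥-elim (x∉ (VecP.lookup⇒[]= x p eq))
... | false = refl

x∈p─q⇒x∉q : ∀ {k} {x : Fin k} (p q : Subset k) → x ∈ p ─ q → x ∉ q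
x∈p─q⇒x∉q (_ Vec.∷ p) (false Vec.∷ q) Vec.here ()
x∈p─q⇒x∉q (_ Vec.∷ p) (_ Vec.∷ q) (Vec.there x∈) (Vec.there x∈q) = x∈p─q⇒x∉q p q x∈ x∈q

parity : ℕ → Bool
parity zero = false
parity (suc k) = not (parity k)

parity-+ : ∀ a b → parity (a ℕ.+ b) ≡ parity a xor parity b
parity-+ zero b = refl
parity-+ (suc a) b rewrite parity-+ a b = BoolP.not-distribˡ-xor (parity a) (parity b)

parity-double : ∀ a → parity (a ℕ.+ a) ≡ false
parity-double a = trans (parity-+ a a) (BoolP.xor-same (parity a))

parity-+-double : ∀ a b → parity (a ℕ.+ (b ℕ.+ b)) ≡ parity a
parity-+-double a b rewrite parity-+ a (b ℕ.+ b) | parity-double b = BoolP.xor-identityʳ (parity a)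

parity-𝟙+𝟙 : ∀ a b → parity (𝟙 a ℕ.+ 𝟙 b) ≡ a xor b
parity-𝟙+𝟙 true true = refl
parity-𝟙+𝟙 true false = refl
parity-𝟙+𝟙 false true = refl
parity-𝟙+𝟙 false false = refl

parity-%2 : ∀ k → k % 2 ≡ 𝟙 (parity k)
parity-%2 zero = refl
parity-%2 (suc zero) = refl
parity-%2 (suc (suc k)) = begin
  (2 ℕ.+ k) % 2        ≡⟨ cong (_% 2) (ℕP.+-comm 2 k) ⟩
  (k ℕ.+ 2) % 2        ≡⟨ [m+n]%n≡m%n k 2 ⟩
  k % 2                ≡⟨ parity-%2 k ⟩
  𝟙 (parity k)         ≡⟨ cong 𝟙 (BoolP.not-involutive (parity k)) ⟨
  𝟙 (parity (2 ℕ.+ k)) ∎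
  where open ≡-Reasoning

odd⇔parity : ∀ k → (k % 2 ≡ 1) ⇔ (parity k ≡ true)
odd⇔parity k = mk⇔ to (λ h → trans (parity-%2 k) (cong 𝟙 h))
  where
  to : k % 2 ≡ 1 → parity k ≡ true
  to h with parity k | parity-%2 k
  ... | true | _ = refl
  ... | false | e = case trans (sym h) e of λ ()

Mask : ℕ → Set
Mask k = Fin k → Bool

module _ {k : ℕ} where

  infixr 7 _∩ᵇ_ _∖ᵇ_
  infixr 6 _∪ᵇ_ _⊕ᵇ_

  _∩ᵇ_ _∪ᵇ_ _⊕ᵇ_ _∖ᵇ_ : Mask k → Mask k → Mask k
  (A ∩ᵇ B) i = A i ∧ B i
  (A ∪ᵇ B) i = A i ∨ B i
  (A ⊕ᵇ B) i = A i xor B i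
  (A ∖ᵇ B) i = A i ∧ not (B i)

  ⁅_⁆ᵇ : Fin k → Mask k
  ⁅ e ⁆ᵇ i = i =ᵇ e

  ∑∈ : Mask k → (Fin k → ℕ) → ℕ
  ∑∈ A g = ∑ (λ i → 𝟙 (A i) ℕ.* g i)

  size : Mask k → ℕ
  size A = ∑∈ A (λ _ → 1)

∑-zero : ∀ {k} {g : Fin k → ℕ} → (∀ i → g i ≡ 0) → ∑ g ≡ 0
∑-zero {k} p = trans (sum-cong-≗ p) (sum-replicate-zero k)

∑-mono-≤ : ∀ {k} {g h : Fin k → ℕ} → (∀ i → g i ≤ h i) → ∑ g ≤ ∑ h
∑-mono-≤ {zero} p = z≤n
∑-mono-≤ {suc k} p = ℕP.+-mono-≤ (p zero) (∑-mono-≤ (p ∘ suc))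

∑-pos : ∀ {k} (g : Fin k → ℕ) → 0 < ∑ g → ∃ λ i → 0 < g i
∑-pos {suc k} g lt with g zero in eq
... | suc _ = zero , subst (0 <_) (sym eq) (s≤s z≤n)
... | zero with ∑-pos (λ i → g (suc i)) lt
... | i , p = suc i , p

∑-δ : ∀ {k} (e : Fin k) (g : Fin k → ℕ) → ∑ (λ i → 𝟙 (i =ᵇ e) ℕ.* g i) ≡ g e
∑-δ {suc k} zero g = trans (cong₂ ℕ._+_ (ℕP.+-identityʳ (g zero)) (sum-replicate-zero k)) (ℕP.+-identityʳ (g zero))
∑-δ {suc k} (suc e) g = ∑-δ e (λ i → g (suc i))

module _ {k : ℕ} where

  ∑∈-cong : ∀ {A B : Mask k} g → (∀ i → A i ≡ B i) → ∑∈ A g ≡ ∑∈ B g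
  ∑∈-cong g p = sum-cong-≗ (λ i → cong (λ b → 𝟙 b ℕ.* g i) (p i))

  ∑∈-pointwise : ∀ (A B C : Mask k) g →
    (∀ i → 𝟙 (A i) ℕ.* g i ≡ 𝟙 (B i) ℕ.* g i ℕ.+ 𝟙 (C i) ℕ.* g i) → ∑∈ A g ≡ ∑∈ B g ℕ.+ ∑∈ C g
  ∑∈-pointwise A B C g p = trans (sum-cong-≗ p) (∑-distrib-+ (λ i → 𝟙 (B i) ℕ.* g i) (λ i → 𝟙 (C i) ℕ.* g i))

  ∑∈-zero : ∀ (A : Mask k) g → (∀ i → A i ≡ true → g i ≡ 0) → ∑∈ A g ≡ 0
  ∑∈-zero A g p = ∑-zero pt
    where
    pt : ∀ i → 𝟙 (A i) ℕ.* g i ≡ 0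
    pt i with A i in eq
    ... | true = trans (ℕP.+-identityʳ (g i)) (p i eq)
    ... | false = refl

  ∑∈-∅ : ∀ g → ∑∈ (λ _ → false) g ≡ 0
  ∑∈-∅ g = ∑∈-zero (λ _ → false) g (λ _ ())

  ∑∈-pos : ∀ (A : Mask k) g → 0 < ∑∈ A g → ∃ λ i → A i ≡ true × 0 < g i
  ∑∈-pos A g lt with ∑-pos _ lt
  ... | i , p with A i in eq
  ... | true = i , eq , subst (0 <_) (ℕP.+-identityʳ (g i)) p
  ... | false = ⊥-elim (ℕP.<-irrefl refl p)

  ∑∈-monoʳ : ∀ (A : Mask k) {g h} → (∀ i → g i ≤ h i) → ∑∈ A g ≤ ∑∈ A h
  ∑∈-monoʳ A p = ∑-mono-≤ (λ i → ℕP.*-monoʳ-≤ (𝟙 (A i)) (p i))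

  size≤ : ∀ (A : Mask k) → size A ≤ k
  size≤ A = ℕP.≤-trans (∑-mono-≤ (λ i → subst (_≤ 1) (sym (ℕP.*-identityʳ (𝟙 (A i)))) (𝟙≤1 (A i))))
                       (ℕP.≤-reflexive (sum-ones k))
    where
    sum-ones : ∀ k → ∑ {k} (λ _ → 1) ≡ k
    sum-ones zero = refl
    sum-ones (suc k) = cong suc (sum-ones k)

  ∑∈-insert : ∀ (A : Mask k) e g → A e ≡ false → ∑∈ (⁅ e ⁆ᵇ ∪ᵇ A) g ≡ g e ℕ.+ ∑∈ A g
  ∑∈-insert A e g Ae = trans (∑∈-pointwise (⁅ e ⁆ᵇ ∪ᵇ A) ⁅ e ⁆ᵇ A g pt) (cong (ℕ._+ ∑∈ A g) (∑-δ e g))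
    where
    pt : ∀ i → 𝟙 ((⁅ e ⁆ᵇ ∪ᵇ A) i) ℕ.* g i ≡ 𝟙 (i =ᵇ e) ℕ.* g i ℕ.+ 𝟙 (A i) ℕ.* g i
    pt i with i ≟ e
    ... | no _ = refl
    ... | yes refl rewrite Ae = sym (ℕP.+-identityʳ _)

  ∑∈-toggle-∉ : ∀ (A : Mask k) e g → A e ≡ false → ∑∈ (A ⊕ᵇ ⁅ e ⁆ᵇ) g ≡ g e ℕ.+ ∑∈ A g
  ∑∈-toggle-∉ A e g Ae = trans (∑∈-cong g pt) (∑∈-insert A e g Ae)
    where
    pt : ∀ i → (A ⊕ᵇ ⁅ e ⁆ᵇ) i ≡ (⁅ e ⁆ᵇ ∪ᵇ A) i
    pt i with i ≟ e
    ... | yes refl rewrite Ae = refl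
    ... | no _ = BoolP.xor-identityʳ (A i)

  ∑∈-toggle-∈ : ∀ (A : Mask k) e g → A e ≡ true → ∑∈ A g ≡ g e ℕ.+ ∑∈ (A ⊕ᵇ ⁅ e ⁆ᵇ) g
  ∑∈-toggle-∈ A e g Ae = trans (∑∈-cong g pt) (∑∈-toggle-∉ (A ⊕ᵇ ⁅ e ⁆ᵇ) e g e∉)
    where
    e∉ : A e xor (e =ᵇ e) ≡ false
    e∉ rewrite Ae | =ᵇ-refl e = refl
    pt : ∀ i → A i ≡ ((A ⊕ᵇ ⁅ e ⁆ᵇ) ⊕ᵇ ⁅ e ⁆ᵇ) i
    pt i = sym (trans (BoolP.xor-assoc (A i) (i =ᵇ e) (i =ᵇ e))
                 (trans (cong (A i xor_) (BoolP.xor-same (i =ᵇ e))) (BoolP.xor-identityʳ (A i))))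

  ∑∈-⊆ : ∀ (A B : Mask k) g → (∀ i → B i ≡ true → A i ≡ true) → ∑∈ A g ≡ ∑∈ (A ∖ᵇ B) g ℕ.+ ∑∈ B g
  ∑∈-⊆ A B g B⊆A = ∑∈-pointwise A (A ∖ᵇ B) B g pt
    where
    pt : ∀ i → 𝟙 (A i) ℕ.* g i ≡ 𝟙 ((A ∖ᵇ B) i) ℕ.* g i ℕ.+ 𝟙 (B i) ℕ.* g i
    pt i with B i in eq
    ... | true rewrite B⊆A i eq = refl
    ... | false rewrite BoolP.∧-identityʳ (A i) = sym (ℕP.+-identityʳ _)

  ∑∈-⊕ : ∀ (A B : Mask k) g →
    ∑∈ (A ⊕ᵇ B) g ℕ.+ (∑∈ (A ∩ᵇ B) g ℕ.+ ∑∈ (A ∩ᵇ B) g) ≡ ∑∈ A g ℕ.+ ∑∈ B g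
  ∑∈-⊕ A B g = begin
    ∑∈ (A ⊕ᵇ B) g ℕ.+ (∑∈ (A ∩ᵇ B) g ℕ.+ ∑∈ (A ∩ᵇ B) g)  ≡⟨ cong (∑∈ (A ⊕ᵇ B) g ℕ.+_) (∑-distrib-+ ∩ᵢ ∩ᵢ) ⟨
    ∑∈ (A ⊕ᵇ B) g ℕ.+ ∑ (λ i → ∩ᵢ i ℕ.+ ∩ᵢ i)           ≡⟨ ∑-distrib-+ (λ i → 𝟙 ((A ⊕ᵇ B) i) ℕ.* g i) (λ i → ∩ᵢ i ℕ.+ ∩ᵢ i) ⟨
    ∑ (λ i → 𝟙 ((A ⊕ᵇ B) i) ℕ.* g i ℕ.+ (∩ᵢ i ℕ.+ ∩ᵢ i)) ≡⟨ sum-cong-≗ pt ⟩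
    ∑ (λ i → 𝟙 (A i) ℕ.* g i ℕ.+ 𝟙 (B i) ℕ.* g i)        ≡⟨ ∑-distrib-+ (λ i → 𝟙 (A i) ℕ.* g i) (λ i → 𝟙 (B i) ℕ.* g i) ⟩
    ∑∈ A g ℕ.+ ∑∈ B g                                    ∎
    where
    open ≡-Reasoning
    ∩ᵢ : Fin k → ℕ
    ∩ᵢ i = 𝟙 (A i ∧ B i) ℕ.* g i
    pt : ∀ i → 𝟙 (A i xor B i) ℕ.* g i ℕ.+ (∩ᵢ i ℕ.+ ∩ᵢ i) ≡ 𝟙 (A i) ℕ.* g i ℕ.+ 𝟙 (B i) ℕ.* g i
    pt i with A i | B i
    ... | true | true = refl
    ... | true | false = refl
    ... | false | true = ℕP.+-identityʳ _
    ... | false | false = refl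

  size-∩ : ∀ (A B : Mask k) → size (A ∩ᵇ B) ≡ ∑∈ B (𝟙 ∘ A)
  size-∩ A B = sum-cong-≗ pt
    where
    pt : ∀ i → 𝟙 (A i ∧ B i) ℕ.* 1 ≡ 𝟙 (B i) ℕ.* 𝟙 (A i)
    pt i with A i | B i
    ... | true | true = refl
    ... | true | false = refl
    ... | false | true = refl
    ... | false | false = refl

size-⊕-balanced : ∀ {k} (A B : Mask k) → size A ≡ size B →
                  size (A ⊕ᵇ B) ≡ ∑∈ (A ⊕ᵇ B) (𝟙 ∘ A) ℕ.+ ∑∈ (A ⊕ᵇ B) (𝟙 ∘ A)
size-⊕-balanced A B |A|≡|B| = ℕP.+-cancelʳ-≡ (∣A∩B∣ ℕ.+ ∣A∩B∣) _ _ (begin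
  size (A ⊕ᵇ B) ℕ.+ (∣A∩B∣ ℕ.+ ∣A∩B∣)          ≡⟨ ∑∈-⊕ A B (λ _ → 1) ⟩
  size A ℕ.+ size B                           ≡⟨ cong (size A ℕ.+_) |A|≡|B| ⟨
  size A ℕ.+ size A                           ≡⟨ cong₂ ℕ._+_ split split ⟩
  (d ℕ.+ ∣A∩B∣) ℕ.+ (d ℕ.+ ∣A∩B∣)              ≡⟨ +-interchange d ∣A∩B∣ d ∣A∩B∣ ⟩
  (d ℕ.+ d) ℕ.+ (∣A∩B∣ ℕ.+ ∣A∩B∣)              ∎)
  where
  open ≡-Reasoning
  d : ℕ
  d = ∑∈ (A ⊕ᵇ B) (𝟙 ∘ A)
  ∣A∩B∣ : ℕ
  ∣A∩B∣ = size (A ∩ᵇ B)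
  split : size A ≡ d ℕ.+ ∣A∩B∣
  split = trans (sum-cong-≗ pt) (∑-distrib-+ (λ i → 𝟙 (A i xor B i) ℕ.* 𝟙 (A i)) (λ i → 𝟙 (A i ∧ B i) ℕ.* 1))
    where
    pt : ∀ i → 𝟙 (A i) ℕ.* 1 ≡ 𝟙 (A i xor B i) ℕ.* 𝟙 (A i) ℕ.+ 𝟙 (A i ∧ B i) ℕ.* 1
    pt i with A i | B i
    ... | true | true = refl
    ... | true | false = refl
    ... | false | true = refl
    ... | false | false = refl

listSum-tabulate : ∀ {k} (g : Fin k → ℕ) → ListAction.sum (List.tabulate g) ≡ ∑ g
listSum-tabulate {zero} g = refl
listSum-tabulate {suc k} g = cong (g zero ℕ.+_) (listSum-tabulate (g ∘ suc))

listSum-allFin : ∀ {k} (g : Fin k → ℕ) → ListAction.sum (List.map g (List.allFin k)) ≡ ∑ g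
listSum-allFin {k} g = trans (cong ListAction.sum (ListP.map-tabulate (λ i → i) g)) (listSum-tabulate g)

∣∣≡size : ∀ {k} (A : Subset k) → ∣ A ∣ ≡ size (lookup A)
∣∣≡size Vec.[] = refl
∣∣≡size (true Vec.∷ A) = cong suc (∣∣≡size A)
∣∣≡size (false Vec.∷ A) = ∣∣≡size A

odd-excess-inherited : ∀ {j k p fj fk fp} → suc j ≡ fj ℕ.+ fj → j ≡ k ℕ.+ p → fj ≡ fk ℕ.+ fp →
                       fk ℕ.+ fk ≤ k → p < fp ℕ.+ fp
odd-excess-inherited {j} {k} {p} {fj} {fk} {fp} 1+j≡2fj j≡k+p fj≡fk+fp 2fk≤k = ℕP.+-cancelˡ-≤ k _ _ (begin
  k ℕ.+ suc p                      ≡⟨ ℕP.+-suc k p ⟩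
  suc (k ℕ.+ p)                    ≡⟨ cong suc j≡k+p ⟨
  suc j                            ≡⟨ 1+j≡2fj ⟩
  fj ℕ.+ fj                        ≡⟨ cong (λ f → f ℕ.+ f) fj≡fk+fp ⟩
  (fk ℕ.+ fp) ℕ.+ (fk ℕ.+ fp)      ≡⟨ +-interchange fk fp fk fp ⟩
  (fk ℕ.+ fk) ℕ.+ (fp ℕ.+ fp)      ≤⟨ ℕP.+-monoˡ-≤ (fp ℕ.+ fp) 2fk≤k ⟩
  k ℕ.+ (fp ℕ.+ fp)                ∎)
  where open ℕP.≤-Reasoning

⊖≡0⇒≡ : ∀ b c → b ⊖ c ≡ + 0 → b ≡ c
⊖≡0⇒≡ b c eq = ℤP.+-injective (ℤP.i-j≡0⇒i≡j (+ b) (+ c) (trans (ℤP.[+m]-[+n]≡m⊖n b c) eq))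

⊖≡-1⇒≡suc : ∀ b c → b ⊖ c ≡ -[1+ 0 ] → suc b ≡ c
⊖≡-1⇒≡suc b c eq = ⊖≡0⇒≡ (suc b) c (trans (sym (ℤP.distribʳ-⊖-+-pos 1 b c)) (cong (λ w → + 1 ℤ.+ w) eq))

-k≤⊖ : ∀ {a b} k → a ≤ b ℕ.+ k → ℤ.- (+ k) ℤ.≤ b ⊖ a
-k≤⊖ {a} {b} k le = subst (ℤ._≤ b ⊖ a) b⊖[b+k]≡-k (ℤP.⊖-monoʳ-≥-≤ b le)
  where
  b⊖[b+k]≡-k : b ⊖ (b ℕ.+ k) ≡ ℤ.- (+ k)
  b⊖[b+k]≡-k = begin
    b ⊖ (b ℕ.+ k)           ≡⟨ cong (_⊖ (b ℕ.+ k)) (ℕP.+-identityʳ b) ⟨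
    (b ℕ.+ 0) ⊖ (b ℕ.+ k)   ≡⟨ ℤP.+-cancelˡ-⊖ b 0 k ⟩
    0 ⊖ k                   ≡⟨ ℤP.-m+n≡n⊖m k 0 ⟨
    ℤ.- (+ k) ℤ.+ + 0       ≡⟨ ℤP.+-identityʳ (ℤ.- (+ k)) ⟩
    ℤ.- (+ k)               ∎
    where open ≡-Reasoning

⊖<0 : ∀ {a b} → b < a → b ⊖ a ℤ.< + 0
⊖<0 {a} {b} lt = subst (b ⊖ a ℤ.<_) (ℤP.n⊖n≡0 a) (ℤP.⊖-monoˡ-< a lt)

≤-+-nonneg : ∀ {a b} → + 0 ℤ.≤ a → b ℤ.≤ a ℤ.+ b
≤-+-nonneg {a} {b} 0≤a = subst (ℤ._≤ a ℤ.+ b) (ℤP.+-identityˡ b) (ℤP.+-monoˡ-≤ b 0≤a)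

Minimum : (ℤ → Set) → ℤ → Set
Minimum P k = P k × (∀ k′ → P k′ → k ℤ.≤ k′)

-- Paths are not enumerated, so minimal weights exist only under double negation; this suffices
-- because they are only used to prove decidable or negative statements.
¬¬minimum : ∀ (P : ℤ → Set) N {k₀} → P k₀ → (∀ k → P k → k₀ ℤ.≤ k ℤ.+ + N) →
            ¬ ¬ (Σ[ k ∈ ℤ ] Minimum P k × k ℤ.≤ k₀)
¬¬minimum P zero {k₀} Pk₀ bound ¬min =
  ¬min (k₀ , (Pk₀ , λ k Pk → subst (k₀ ℤ.≤_) (ℤP.+-identityʳ k) (bound k Pk)) , ℤP.≤-refl)
¬¬minimum P (suc N) {k₀} Pk₀ bound ¬min = ¬¬-excluded-middle λ
  { (no ¬smaller) → ¬min (k₀ , (Pk₀ , λ k Pk → ℤP.≮⇒≥ (λ k<k₀ → ¬smaller (k , Pk , k<k₀))) , ℤP.≤-refl)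
  ; (yes (k₁ , Pk₁ , k₁<k₀)) → ¬¬minimum P N Pk₁ (λ k Pk → tighten {k = k} k₁<k₀ (bound k Pk))
      (λ (k , min , k≤k₁) → ¬min (k , min , ℤP.≤-trans k≤k₁ (ℤP.<⇒≤ k₁<k₀))) }
  where
  tighten : ∀ {k₁ k} → k₁ ℤ.< k₀ → k₀ ℤ.≤ k ℤ.+ + suc N → k₁ ℤ.≤ k ℤ.+ + N
  tighten {k₁} {k} k₁<k₀ k₀≤ = subst (k₁ ℤ.≤_) pred[k+1+N]≡k+N (ℤP.i<j⇒i≤pred[j] (ℤP.<-≤-trans k₁<k₀ k₀≤))
    where
    pred[k+1+N]≡k+N : ℤ.pred (k ℤ.+ + suc N) ≡ k ℤ.+ + N
    pred[k+1+N]≡k+N = trans (cong ℤ.pred (ℤP.+-comm k (+ suc N)))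
                        (trans (sym (ℤP.pred-+ (+ suc N) k)) (ℤP.+-comm (+ N) k))

fin≤fin⁻¹ : ∀ {a b} → fin a ≤∞ fin b → a ℤ.≤ b
fin≤fin⁻¹ (fin≤fin a≤b) = a≤b

fin<fin : ∀ {a b} → a ℤ.< b → fin a <∞ fin b
fin<fin a<b = fin≤fin (ℤP.<⇒≤ a<b) , λ { refl → ℤP.<-irrefl refl a<b }

≤∞-antisym : ∀ {a b} → a ≤∞ b → b ≤∞ a → a ≡ b
≤∞-antisym (fin≤fin a≤b) (fin≤fin b≤a) = cong fin (ℤP.≤-antisym a≤b b≤a)
≤∞-antisym (_ ≤∞∞) (_ ≤∞∞) = refl

module Incidence {n m : ℕ} (M : Multigraph n m) where
  open Multigraph M

  end₁ end₂ : Fin m → Fin n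
  end₁ e = proj₁ (ends e)
  end₂ e = proj₂ (ends e)

  incidence : Fin m → Fin n → ℕ
  incidence e v = 𝟙 (end₁ e =ᵇ v) ℕ.+ 𝟙 (end₂ e =ᵇ v)

  degree : Mask m → Fin n → ℕ
  degree A v = ∑∈ A (λ e → incidence e v)

  deg≡degree : ∀ (A : Subset m) v → deg M A v ≡ degree (lookup A) v
  deg≡degree A v = trans (listSum-allFin summand) (sum-cong-≗ λ e →
    cong₂ ℕ._*_ (ind≡𝟙 (lookup A e)) (cong₂ ℕ._+_ (eqb≡ (end₁ e) v) (eqb≡ (end₂ e) v)))
    where
    summand : Fin m → ℕ
    summand e = ind M (lookup A e) ℕ.* (ind M (eqb M (end₁ e) v) ℕ.+ ind M (eqb M (end₂ e) v))
    ind≡𝟙 : ∀ b → ind M b ≡ 𝟙 b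
    ind≡𝟙 true = refl
    ind≡𝟙 false = refl
    eqb≡ : ∀ u v → ind M (eqb M u v) ≡ 𝟙 (u =ᵇ v)
    eqb≡ u v = trans (ind≡𝟙 (eqb M u v)) (cong 𝟙 (isYes≗does (u ≟ v)))

  Joins-sym : ∀ {e x y} → Joins M e x y → Joins M e y x
  Joins-sym (inj₁ p) = inj₂ p
  Joins-sym (inj₂ p) = inj₁ p

  parity-incidence : ∀ {e x y} → Joins M e x y → ∀ v → parity (incidence e v) ≡ (x =ᵇ v) xor (y =ᵇ v)
  parity-incidence {x = x} {y} (inj₁ refl) v = parity-𝟙+𝟙 (x =ᵇ v) (y =ᵇ v)
  parity-incidence {x = x} {y} (inj₂ refl) v =
    trans (parity-𝟙+𝟙 (y =ᵇ v) (x =ᵇ v)) (BoolP.xor-comm (y =ᵇ v) (x =ᵇ v))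

  parity-degree-⊕ : ∀ A B v → parity (degree (A ⊕ᵇ B) v) ≡ parity (degree A v) xor parity (degree B v)
  parity-degree-⊕ A B v = begin
    parity (degree (A ⊕ᵇ B) v)                      ≡⟨ parity-+-double (degree (A ⊕ᵇ B) v) (∑∈ (A ∩ᵇ B) (λ e → incidence e v)) ⟨
    parity (degree (A ⊕ᵇ B) v ℕ.+ (d∩ ℕ.+ d∩))       ≡⟨ cong parity (∑∈-⊕ A B (λ e → incidence e v)) ⟩
    parity (degree A v ℕ.+ degree B v)              ≡⟨ parity-+ (degree A v) (degree B v) ⟩
    parity (degree A v) xor parity (degree B v)     ∎
    where
    open ≡-Reasoning
    d∩ : ℕ
    d∩ = ∑∈ (A ∩ᵇ B) (λ e → incidence e v)

  degree-⁅⁆ : ∀ e v → degree ⁅ e ⁆ᵇ v ≡ incidence e v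
  degree-⁅⁆ e v = ∑-δ e (λ e → incidence e v)

  incident⇒Joins : ∀ e u → 0 < incidence e u → Σ[ w ∈ Fin n ] Joins M e u w
  incident⇒Joins e u h with end₁ e ≟ u | end₂ e ≟ u
  ... | yes refl | _ = end₂ e , inj₁ refl
  ... | no _ | yes refl = end₁ e , inj₂ refl
  ... | no _ | no _ = ⊥-elim (ℕP.<-irrefl refl h)

  odd⇒incidentEdge : ∀ J u → parity (degree J u) ≡ true → Σ[ e ∈ Fin m ] J e ≡ true × Σ[ w ∈ Fin n ] Joins M e u w
  odd⇒incidentEdge J u odd =
    let e , Je , pos = ∑∈-pos J (λ e → incidence e u) (odd⇒pos (degree J u) odd)
    in e , Je , incident⇒Joins e u pos
    where
    odd⇒pos : ∀ k → parity k ≡ true → 0 < k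
    odd⇒pos (suc k) _ = s≤s z≤n

  Even : Mask m → Set
  Even E = ∀ v → parity (degree E v) ≡ false

  parity-degree-⊕-even : ∀ A E → Even E → ∀ v → parity (degree (A ⊕ᵇ E) v) ≡ parity (degree A v)
  parity-degree-⊕-even A E even v = begin
    parity (degree (A ⊕ᵇ E) v)                    ≡⟨ parity-degree-⊕ A E v ⟩
    parity (degree A v) xor parity (degree E v)   ≡⟨ cong (parity (degree A v) xor_) (even v) ⟩
    parity (degree A v) xor false                 ≡⟨ BoolP.xor-identityʳ _ ⟩
    parity (degree A v)                           ∎
    where open ≡-Reasoning

  OddExactlyAt : Mask m → Fin n → Fin n → Set
  OddExactlyAt J u v = ∀ w → parity (degree J w) ≡ (u =ᵇ w) xor (v =ᵇ w)

  OddExactlyAt-toggle : ∀ {J u v w e} → OddExactlyAt J u v → Joins M e u w → OddExactlyAt (J ⊕ᵇ ⁅ e ⁆ᵇ) w v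
  OddExactlyAt-toggle {J} {u} {v} {w} {e} odd j x = begin
    parity (degree (J ⊕ᵇ ⁅ e ⁆ᵇ) x)                          ≡⟨ parity-degree-⊕ J ⁅ e ⁆ᵇ x ⟩
    parity (degree J x) xor parity (degree ⁅ e ⁆ᵇ x)         ≡⟨ cong₂ _xor_ (odd x) (trans (cong parity (degree-⁅⁆ e x)) (parity-incidence j x)) ⟩
    ((u =ᵇ x) xor (v =ᵇ x)) xor ((u =ᵇ x) xor (w =ᵇ x))       ≡⟨ xor-cancel-left (u =ᵇ x) (v =ᵇ x) (w =ᵇ x) ⟩
    (w =ᵇ x) xor (v =ᵇ x)                                   ∎
    where open ≡-Reasoning

  Even-toggle : ∀ {D u c e} → Even D → Joins M e u c → OddExactlyAt (D ⊕ᵇ ⁅ e ⁆ᵇ) u c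
  Even-toggle {D} {u} {c} {e} even j v = begin
    parity (degree (D ⊕ᵇ ⁅ e ⁆ᵇ) v)                   ≡⟨ parity-degree-⊕ D ⁅ e ⁆ᵇ v ⟩
    parity (degree D v) xor parity (degree ⁅ e ⁆ᵇ v)  ≡⟨ cong₂ _xor_ (even v) (trans (cong parity (degree-⁅⁆ e v)) (parity-incidence j v)) ⟩
    (u =ᵇ v) xor (c =ᵇ v)                             ∎
    where open ≡-Reasoning

  OddExactlyAt-close : ∀ {J u c e} → OddExactlyAt J u c → Joins M e u c → Even (J ⊕ᵇ ⁅ e ⁆ᵇ)
  OddExactlyAt-close {J} {u} {c} {e} odd j v = begin
    parity (degree (J ⊕ᵇ ⁅ e ⁆ᵇ) v)                   ≡⟨ parity-degree-⊕ J ⁅ e ⁆ᵇ v ⟩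
    parity (degree J v) xor parity (degree ⁅ e ⁆ᵇ v)  ≡⟨ cong₂ _xor_ (odd v) (trans (cong parity (degree-⁅⁆ e v)) (parity-incidence j v)) ⟩
    ((u =ᵇ v) xor (c =ᵇ v)) xor ((u =ᵇ v) xor (c =ᵇ v)) ≡⟨ BoolP.xor-same ((u =ᵇ v) xor (c =ᵇ v)) ⟩
    false                                             ∎
    where open ≡-Reasoning

module Walks {n m : ℕ} (M : Multigraph n m) where
  open Incidence M public

  edge : ∀ {e x y} → Joins M e x y → Walk M (whole M) x y
  edge {e} j = cons e SubsetP.∈⊤ j (nil _)

  edge-isPath : ∀ {e x y} (j : Joins M e x y) → x ≢ y → IsPath M (edge j)
  edge-isPath j x≢y = SubsetP.∈⊤ ∷ SubsetP.∈⊤ ∷ [] , (x≢y ∷ []) ∷ [] ∷ []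

  module _ {S : SubG M} where

    first∈verts : ∀ {x y} (W : Walk M S x y) → x ∈ₗ verts M W
    first∈verts (nil x) = here refl
    first∈verts (cons e _ _ W) = here refl

    last∈verts : ∀ {x y} (W : Walk M S x y) → y ∈ₗ verts M W
    last∈verts (nil x) = here refl
    last∈verts (cons e _ _ W) = there (last∈verts W)

    ends∈verts : ∀ {x y} (W : Walk M S x y) {e} → e ∈ₗ edgesOf M W → end₁ e ∈ₗ verts M W × end₂ e ∈ₗ verts M W
    ends∈verts (cons e′ _ (inj₁ refl) W) (here refl) = here refl , there (first∈verts W)
    ends∈verts (cons e′ _ (inj₂ refl) W) (here refl) = there (first∈verts W) , here refl
    ends∈verts (cons e′ _ _ W) (there p) with ends∈verts W p
    ... | a , b = there a , there b

    tail-isPath : ∀ {x y z} e e∈ (j : Joins M e x y) (W : Walk M S y z) → IsPath M (cons e e∈ j W) → IsPath M W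
    tail-isPath e e∈ j W (_ ∷ vs , _ ∷ u) = vs , u

    closedPath-nil : ∀ {x} (W : Walk M S x x) → IsPath M W → W ≡ nil x
    closedPath-nil (nil x) _ = refl
    closedPath-nil (cons e _ _ W) (_ , (x∉ ∷ _)) = ⊥-elim (All.lookup x∉ (last∈verts W) refl)

  edgeWeight : Subset m → Fin m → ℤ
  edgeWeight F e = if lookup F e then -[1+ 0 ] else + 1

  edgeWeight≤1 : ∀ F e → edgeWeight F e ℤ.≤ + 1
  edgeWeight≤1 F e with lookup F e
  ... | true = ℤ.-≤+
  ... | false = ℤP.≤-refl

  wt-++ : ∀ F es fs → wt M F (es ++ fs) ≡ wt M F es ℤ.+ wt M F fs
  wt-++ F [] fs = sym (ℤP.+-identityˡ _)
  wt-++ F (e ∷ es) fs rewrite wt-++ F es fs = sym (ℤP.+-assoc (edgeWeight F e) _ _)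

  transport : ∀ {S S′ x y} (W : Walk M S x y) → All (_∈ E S′) (edgesOf M W) → Walk M S′ x y
  transport (nil x) _ = nil x
  transport (cons e _ j W) (e∈ ∷ es) = cons e e∈ j (transport W es)

  module _ {S S′ : SubG M} where

    transport-verts : ∀ {x y} (W : Walk M S x y) es → verts M (transport {S′ = S′} W es) ≡ verts M W
    transport-verts (nil x) _ = refl
    transport-verts (cons {x = x} e _ j W) (_ ∷ es) = cong (x ∷_) (transport-verts W es)

    transport-edges : ∀ {x y} (W : Walk M S x y) es → edgesOf M (transport {S′ = S′} W es) ≡ edgesOf M W
    transport-edges (nil x) _ = refl
    transport-edges (cons e _ j W) (_ ∷ es) = cong (e ∷_) (transport-edges W es)

    weight-transport : ∀ {x y} F (W : Walk M S x y) es → weight M F (transport {S′ = S′} W es) ≡ weight M F W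
    weight-transport F W es = cong (wt M F) (transport-edges W es)

    transport-isPath : ∀ {x y} (W : Walk M S x y) es → All (_∈ V S′) (verts M W) → IsPath M W →
                       IsPath M (transport {S′ = S′} W es)
    transport-isPath W es vs (_ , u) = subst (All (_∈ V S′)) (sym eq) vs , subst Unique (sym eq) u
      where eq = transport-verts W es

  embed : ∀ {S x y} → Walk M S x y → Walk M (whole M) x y
  embed W = transport W (All.tabulate (λ _ → SubsetP.∈⊤))

  embed-isPath : ∀ {S x y} (W : Walk M S x y) → IsPath M W → IsPath M (embed W)
  embed-isPath W = transport-isPath W _ (All.tabulate (λ _ → SubsetP.∈⊤))

  weight-embed : ∀ {S x y} F (W : Walk M S x y) → weight M F (embed W) ≡ weight M F W
  weight-embed F W = weight-transport F W _

  module _ {S : SubG M} where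

    record Split {x y} (W : Walk M S x y) (c : Fin n) : Set where
      field
        prefix : Walk M S x c
        suffix : Walk M S c y
        prefix-isPath : IsPath M prefix
        suffix-isPath : IsPath M suffix
        weight-split : ∀ F → weight M F W ≡ weight M F prefix ℤ.+ weight M F suffix
        prefix-verts⊆ : ∀ {v} → v ∈ₗ verts M prefix → v ∈ₗ verts M W
        suffix-edges⊆ : ∀ {e} → e ∈ₗ edgesOf M suffix → e ∈ₗ edgesOf M W

    split : ∀ {x y c} (W : Walk M S x y) → IsPath M W → c ∈ₗ verts M W → Split W c
    split (nil x) p (here refl) = record
      { prefix = nil x ; suffix = nil x ; prefix-isPath = p ; suffix-isPath = p
      ; weight-split = λ F → refl ; prefix-verts⊆ = λ q → q ; suffix-edges⊆ = λ q → q }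
    split (cons e e∈ j W) p (here refl) = record
      { prefix = nil _ ; suffix = cons e e∈ j W
      ; prefix-isPath = (All.head (proj₁ p) ∷ []) , ([] ∷ []) ; suffix-isPath = p
      ; weight-split = λ F → sym (ℤP.+-identityˡ _)
      ; prefix-verts⊆ = λ { (here refl) → here refl } ; suffix-edges⊆ = λ q → q }
    split (cons e e∈ j W) (x∈ ∷ vs , x∉ ∷ u) (there q) = record
      { prefix = cons e e∈ j prefix ; suffix = suffix
      ; prefix-isPath = (x∈ ∷ proj₁ prefix-isPath) ,
                        (All.tabulate (λ v∈ → All.lookup x∉ (prefix-verts⊆ v∈)) ∷ proj₂ prefix-isPath)
      ; suffix-isPath = suffix-isPath
      ; weight-split = λ F → trans (cong (λ w → edgeWeight F e ℤ.+ w) (weight-split F)) (sym (ℤP.+-assoc (edgeWeight F e) _ _))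
      ; prefix-verts⊆ = λ { (here refl) → here refl ; (there v∈) → there (prefix-verts⊆ v∈) }
      ; suffix-edges⊆ = λ e∈ → there (suffix-edges⊆ e∈) }
      where open Split (split W (vs , u) q)

    snoc : ∀ {x y z} → Walk M S x y → (e : Fin m) → e ∈ E S → Joins M e y z → Walk M S x z
    snoc (nil x) e e∈ j = cons e e∈ j (nil _)
    snoc (cons e′ e′∈ j′ W) e e∈ j = cons e′ e′∈ j′ (snoc W e e∈ j)

    snoc-verts : ∀ {x y z} (W : Walk M S x y) e e∈ (j : Joins M e y z) → verts M (snoc W e e∈ j) ≡ verts M W ++ (z ∷ [])
    snoc-verts (nil x) e e∈ j = refl
    snoc-verts (cons {x = x} e′ e′∈ j′ W) e e∈ j = cong (x ∷_) (snoc-verts W e e∈ j)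

    snoc-edges : ∀ {x y z} (W : Walk M S x y) e e∈ (j : Joins M e y z) → edgesOf M (snoc W e e∈ j) ≡ edgesOf M W ++ (e ∷ [])
    snoc-edges (nil x) e e∈ j = refl
    snoc-edges (cons e′ e′∈ j′ W) e e∈ j = cong (e′ ∷_) (snoc-edges W e e∈ j)

    rev : ∀ {x y} → Walk M S x y → Walk M S y x
    rev (nil x) = nil x
    rev (cons e e∈ j W) = snoc (rev W) e e∈ (Joins-sym j)

    rev-verts⊆ : ∀ {x y} (W : Walk M S x y) {v} → v ∈ₗ verts M (rev W) → v ∈ₗ verts M W
    rev-verts⊆ (nil x) q = q
    rev-verts⊆ (cons e e∈ j W) q rewrite snoc-verts (rev W) e e∈ (Joins-sym j) with ∈ₗP.∈-++⁻ (verts M (rev W)) q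
    ... | inj₁ q′ = there (rev-verts⊆ W q′)
    ... | inj₂ (here refl) = here refl

    rev-isPath : ∀ {x y} (W : Walk M S x y) → IsPath M W → IsPath M (rev W)
    rev-isPath (nil x) p = p
    rev-isPath {x = x} (cons e e∈ j W) (x∈ ∷ vs , x∉ ∷ u) rewrite snoc-verts (rev W) e e∈ (Joins-sym j) =
      let vs′ , u′ = rev-isPath W (vs , u)
      in AllP.++⁺ vs′ (x∈ ∷ []) , unique-snoc u′ (λ q → All.lookup x∉ (rev-verts⊆ W q) refl)
      where
      unique-snoc : ∀ {xs : List (Fin n)} {z} → Unique xs → z ∉ₗ xs → Unique (xs ++ (z ∷ []))
      unique-snoc {[]} [] z∉ = [] ∷ []
      unique-snoc {_ ∷ xs} (a ∷ u) z∉ = AllP.++⁺ a ((λ eq → z∉ (here (sym eq))) ∷ []) ∷ unique-snoc u (z∉ ∘ there)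

    weight-rev : ∀ {x y} F (W : Walk M S x y) → weight M F (rev W) ≡ weight M F W
    weight-rev F (nil x) = refl
    weight-rev F (cons e e∈ j W) = begin
      wt M F (edgesOf M (snoc (rev W) e e∈ (Joins-sym j)))   ≡⟨ cong (wt M F) (snoc-edges (rev W) e e∈ (Joins-sym j)) ⟩
      wt M F (edgesOf M (rev W) ++ (e ∷ []))                ≡⟨ wt-++ F (edgesOf M (rev W)) (e ∷ []) ⟩
      weight M F (rev W) ℤ.+ (edgeWeight F e ℤ.+ + 0)        ≡⟨ cong₂ ℤ._+_ (weight-rev F W) (ℤP.+-identityʳ (edgeWeight F e)) ⟩
      weight M F W ℤ.+ edgeWeight F e                       ≡⟨ ℤP.+-comm (weight M F W) (edgeWeight F e) ⟩
      edgeWeight F e ℤ.+ weight M F W                       ∎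
      where open ≡-Reasoning

module PathEdges {n m : ℕ} (M : Multigraph n m) where
  open Walks M
  open import Data.List.Membership.DecPropositional (_≟_ {m}) using (_∈?_)

  edgeMask : ∀ {S x y} → Walk M S x y → Mask m
  edgeMask W e = does (e ∈? edgesOf M W)

  size∩ : Subset m → Mask m → ℕ
  size∩ F A = ∑∈ A (𝟙 ∘ lookup F)

  size∩≤size : ∀ F A → size∩ F A ≤ size A
  size∩≤size F A = ∑∈-monoʳ A (λ e → 𝟙≤1 (lookup F e))

  module _ {S : SubG M} where

    edgeMask-∉ : ∀ {x y z e} → Joins M e x y → (W : Walk M S y z) → x ∉ₗ verts M W → edgeMask W e ≡ false
    edgeMask-∉ {e = e} j W x∉ = dec-false (e ∈? edgesOf M W) (λ e∈ → x∉ (end∈ j (ends∈verts W e∈)))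
      where
      end∈ : ∀ {x y} → Joins M e x y → end₁ e ∈ₗ verts M W × end₂ e ∈ₗ verts M W → x ∈ₗ verts M W
      end∈ (inj₁ refl) (a , _) = a
      end∈ (inj₂ refl) (_ , b) = b

    weight-path : ∀ {x y} F (W : Walk M S x y) → IsPath M W →
                  weight M F W ≡ size (edgeMask W) ⊖ (size∩ F (edgeMask W) ℕ.+ size∩ F (edgeMask W))
    weight-path F (nil x) _ = sym (cong₂ _⊖_ (∑∈-∅ {m} (λ _ → 1)) (cong₂ ℕ._+_ (∑∈-∅ {m} (𝟙 ∘ lookup F)) (∑∈-∅ {m} (𝟙 ∘ lookup F))))
    weight-path F (cons e e∈ j W) (_ ∷ vs , x∉ ∷ u)
      rewrite ∑∈-insert (edgeMask W) e (λ _ → 1) (edgeMask-∉ j W (AllP.All¬⇒¬Any x∉))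
            | ∑∈-insert (edgeMask W) e (𝟙 ∘ lookup F) (edgeMask-∉ j W (AllP.All¬⇒¬Any x∉))
            | weight-path F W (vs , u)
            = step (lookup F e) (size (edgeMask W)) (size∩ F (edgeMask W))
      where
      step : ∀ b N o → (if b then -[1+ 0 ] else + 1) ℤ.+ (N ⊖ (o ℕ.+ o)) ≡ suc N ⊖ ((𝟙 b ℕ.+ o) ℕ.+ (𝟙 b ℕ.+ o))
      step false N o = ℤP.distribʳ-⊖-+-pos 1 N (o ℕ.+ o)
      step true N o = begin
        -[1+ 0 ] ℤ.+ (N ⊖ (o ℕ.+ o))  ≡⟨ ℤP.distribʳ-⊖-+-neg 0 N (o ℕ.+ o) ⟩
        N ⊖ suc (o ℕ.+ o)             ≡⟨ cong (N ⊖_) (ℕP.+-suc o o) ⟨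
        N ⊖ (o ℕ.+ suc o)             ≡⟨ ℤP.[1+m]⊖[1+n]≡m⊖n N (o ℕ.+ suc o) ⟨
        suc N ⊖ (suc o ℕ.+ suc o)     ∎
        where open ≡-Reasoning

    parity-degree-path : ∀ {x y} (W : Walk M S x y) → IsPath M W →
                         ∀ v → parity (degree (edgeMask W) v) ≡ (x =ᵇ v) xor (y =ᵇ v)
    parity-degree-path {x} (nil x) _ v = trans (cong parity (∑∈-∅ {m} (λ e → incidence e v))) (sym (BoolP.xor-same (x =ᵇ v)))
    parity-degree-path {x} {z} (cons {y = y} e e∈ j W) (_ ∷ vs , x∉ ∷ u) v
      rewrite ∑∈-insert (edgeMask W) e (λ e → incidence e v) (edgeMask-∉ j W (AllP.All¬⇒¬Any x∉))
            | parity-+ (incidence e v) (degree (edgeMask W) v)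
            | parity-incidence j v
            | parity-degree-path W (vs , u) v
            = xor-cancel-middle (x =ᵇ v) (y =ᵇ v) (z =ᵇ v)

    weight-path-≤ : ∀ {x y} F (W : Walk M S x y) → IsPath M W → weight M F W ℤ.≤ + m
    weight-path-≤ F W p = subst (ℤ._≤ + m) (sym (weight-path F W p))
      (ℤP.≤-trans (ℤP.m⊖n≤m (size (edgeMask W)) (size∩ F (edgeMask W) ℕ.+ size∩ F (edgeMask W))) (ℤ.+≤+ (size≤ (edgeMask W))))

    -m≤weight-path : ∀ {x y} F (W : Walk M S x y) → IsPath M W → ℤ.- (+ m) ℤ.≤ weight M F W
    -m≤weight-path F W p = subst (ℤ.- (+ m) ℤ.≤_) (sym (weight-path F W p))
      (-k≤⊖ m (ℕP.+-mono-≤ o≤N (ℕP.≤-trans o≤N (size≤ (edgeMask W)))))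
      where
      o≤N : size∩ F (edgeMask W) ≤ size (edgeMask W)
      o≤N = size∩≤size F (edgeMask W)

module PathExtraction {n m : ℕ} (M : Multigraph n m) where
  open Walks M
  open PathEdges M
  open import Data.List.Membership.DecPropositional (_≟_ {m}) using (_∈?_)
  open import Data.List.Membership.DecPropositional (_≟_ {n}) using () renaming (_∈?_ to _∈ᵥ?_)

  PathWithin : Mask m → Fin n → Fin n → Set
  PathWithin J u v = Σ[ W ∈ Walk M (whole M) u v ] IsPath M W × (∀ e → e ∈ₗ edgesOf M W → J e ≡ true)

  toggle-⊆ : ∀ (J : Mask m) e → J e ≡ true → ∀ i → (J ⊕ᵇ ⁅ e ⁆ᵇ) i ≡ true → J i ≡ true
  toggle-⊆ J e Je i h with i ≟ e
  ... | yes refl = Je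
  ... | no _ = trans (sym (BoolP.xor-identityʳ (J i))) h

  prependWithin : ∀ {J u w v e} → J e ≡ true → Joins M e u w → PathWithin (J ⊕ᵇ ⁅ e ⁆ᵇ) w v → PathWithin J u v
  prependWithin {J} {u} {e = e} Je j (W , p , W⊆) with u ∈ᵥ? verts M W
  ... | no u∉ = cons e SubsetP.∈⊤ j W , (SubsetP.∈⊤ ∷ proj₁ p , AllP.¬Any⇒All¬ _ u∉ ∷ proj₂ p) ,
                λ { e′ (here refl) → Je ; e′ (there e′∈) → toggle-⊆ J e Je e′ (W⊆ e′ e′∈) }
  ... | yes u∈ = suffix , suffix-isPath , λ e′ e′∈ → toggle-⊆ J e Je e′ (W⊆ e′ (suffix-edges⊆ e′∈))
    where open Split (split W p u∈)

  pathWithin-fuel : ∀ N J {u v} → size J ≤ N → u ≢ v → OddExactlyAt J u v → PathWithin J u v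
  pathWithin-fuel N J {u} {v} J≤N u≢v odd =
    let e , Je , w , j = odd⇒incidentEdge J u u-odd in continue N J≤N Je j (w ≟ v)
    where
    u-odd : parity (degree J u) ≡ true
    u-odd = trans (odd u) (cong₂ _xor_ (=ᵇ-refl u) (dec-false (v ≟ u) (u≢v ∘ sym)))
    continue : ∀ N → size J ≤ N → ∀ {e w} → J e ≡ true → Joins M e u w → Dec (w ≡ v) → PathWithin J u v
    continue _ _ Je j (yes refl) = edge j , edge-isPath j u≢v , λ { e′ (here refl) → Je }
    continue zero J≤0 {e} Je j (no _) =
      ⊥-elim (ℕP.<-irrefl refl (ℕP.≤-trans (subst (1 ≤_) (sym (∑∈-toggle-∈ J e (λ _ → 1) Je)) (s≤s z≤n)) J≤0))
    continue (suc N) J≤1+N {e} Je j (no w≢v) =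
      prependWithin Je j (pathWithin-fuel N (J ⊕ᵇ ⁅ e ⁆ᵇ) J′≤N w≢v (OddExactlyAt-toggle {J} {v = v} odd j))
      where
      J′≤N : size (J ⊕ᵇ ⁅ e ⁆ᵇ) ≤ N
      J′≤N = ℕP.+-cancelˡ-≤ 1 _ _ (subst (_≤ suc N) (∑∈-toggle-∈ J e (λ _ → 1) Je) J≤1+N)

  pathWithin : ∀ J {u v} → u ≢ v → OddExactlyAt J u v → PathWithin J u v
  pathWithin J = pathWithin-fuel (size J) J ℕP.≤-refl

  edgeMask⊆ : ∀ {J u v} (R : PathWithin J u v) → ∀ i → edgeMask (proj₁ R) i ≡ true → J i ≡ true
  edgeMask⊆ (R , _ , R⊆J) i h = R⊆J i (does-true⇒ (i ∈? edgesOf M R) h)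

  OddExactlyAt-∖path : ∀ {J u v} → OddExactlyAt J u v → (R : PathWithin J u v) → Even (J ∖ᵇ edgeMask (proj₁ R))
  OddExactlyAt-∖path {J} {u} {v} odd R@(W , p , _) x = xor≡self⇒false (begin
    parity (degree K x) xor ((u =ᵇ x) xor (v =ᵇ x))  ≡⟨ cong (parity (degree K x) xor_) (parity-degree-path W p x) ⟨
    parity (degree K x) xor parity (degree P x)     ≡⟨ parity-+ (degree K x) (degree P x) ⟨
    parity (degree K x ℕ.+ degree P x)              ≡⟨ cong parity (∑∈-⊆ J P (λ e → incidence e x) (edgeMask⊆ R)) ⟨
    parity (degree J x)                             ≡⟨ odd x ⟩
    (u =ᵇ x) xor (v =ᵇ x)                           ∎)
    where
    open ≡-Reasoning
    P K : Mask m
    P = edgeMask W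
    K = J ∖ᵇ P

module BipartiteWalks {n m : ℕ} (M : Multigraph n m) (col : Fin n → Bool) (bip : Bipartite M col (whole M)) where
  open Walks M
  open PathEdges M

  Joins⇒colour≢ : ∀ {e x y} → Joins M e x y → col x ≢ col y
  Joins⇒colour≢ (inj₁ refl) = bip _ SubsetP.∈⊤
  Joins⇒colour≢ (inj₂ refl) = bip _ SubsetP.∈⊤ ∘ sym

  Joins⇒≢ : ∀ {e x y} → Joins M e x y → x ≢ y
  Joins⇒≢ j refl = Joins⇒colour≢ j refl

  module _ {S : SubG M} where

    parity-size-path : ∀ {x y} (W : Walk M S x y) → IsPath M W → parity (size (edgeMask W)) ≡ col x xor col y
    parity-size-path {x} (nil x) _ = trans (cong parity (∑∈-∅ {m} (λ _ → 1))) (sym (BoolP.xor-same (col x)))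
    parity-size-path {x} {z} (cons {y = y} e e∈ j W) (_ ∷ vs , x∉ ∷ u)
      rewrite ∑∈-insert (edgeMask W) e (λ _ → 1) (edgeMask-∉ j W (AllP.All¬⇒¬Any x∉))
            | parity-size-path W (vs , u)
            = flip (col x) (col y) (col z) (Joins⇒colour≢ j)
      where
      flip : ∀ a b c → a ≢ b → not (b xor c) ≡ a xor c
      flip true true c a≢b = ⊥-elim (a≢b refl)
      flip true false c _ = refl
      flip false true c _ = BoolP.not-involutive c
      flip false false c a≢b = ⊥-elim (a≢b refl)

    weight-path-≢0 : ∀ {x y} F (W : Walk M S x y) → IsPath M W → col x ≢ col y → weight M F W ≢ + 0
    weight-path-≢0 {x} {y} F W p c≢ w≡0 = c≢ (xor≡false⇒≡ (col x) (col y) (begin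
      col x xor col y              ≡⟨ parity-size-path W p ⟨
      parity (size (edgeMask W))  ≡⟨ cong parity N≡o+o ⟩
      parity (o ℕ.+ o)            ≡⟨ parity-double o ⟩
      false                       ∎))
      where
      open ≡-Reasoning
      o : ℕ
      o = size∩ F (edgeMask W)
      N≡o+o : size (edgeMask W) ≡ o ℕ.+ o
      N≡o+o = ⊖≡0⇒≡ (size (edgeMask W)) (o ℕ.+ o) (trans (sym (weight-path F W p)) w≡0)

    weight-path-≢-1 : ∀ {x y} F (W : Walk M S x y) → IsPath M W → col x ≡ col y → weight M F W ≢ -[1+ 0 ]
    weight-path-≢-1 {x} {y} F W p c≡ w≡-1 = case (begin
      true                            ≡⟨ cong not (BoolP.xor-same (col x)) ⟨
      not (col x xor col x)           ≡⟨ cong (λ c → not (col x xor c)) c≡ ⟩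
      not (col x xor col y)           ≡⟨ cong not (parity-size-path W p) ⟨
      parity (suc (size (edgeMask W))) ≡⟨ cong parity 1+N≡o+o ⟩
      parity (o ℕ.+ o)                ≡⟨ parity-double o ⟩
      false                           ∎) of λ ()
      where
      open ≡-Reasoning
      o : ℕ
      o = size∩ F (edgeMask W)
      1+N≡o+o : suc (size (edgeMask W)) ≡ o ℕ.+ o
      1+N≡o+o = ⊖≡-1⇒≡suc (size (edgeMask W)) (o ℕ.+ o) (trans (sym (weight-path F W p)) w≡-1)

module MinimumJoins {n m : ℕ} (M : Multigraph n m) (T : Subset n) (F : Subset m)
                    (minF : IsMinJoin M (whole M) T F) where
  open Walks M
  open PathEdges M
  open PathExtraction M

  odd⇔parityDegree : ∀ A v → (deg M A v % 2 ≡ 1) ⇔ (parity (degree (lookup A) v) ≡ true)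
  odd⇔parityDegree A v = subst (λ d → (deg M A v % 2 ≡ 1) ⇔ (parity d ≡ true)) (deg≡degree A v) (odd⇔parity (deg M A v))

  odd⇔∈T : ∀ {A} → IsJoin M (whole M) T A → ∀ v → (parity (degree (lookup A) v) ≡ true) ⇔ v ∈ T
  odd⇔∈T {A} (_ , odd⇔) v = odd⇔ v SubsetP.∈⊤ ⇔-∘ ⇔-sym (odd⇔parityDegree A v)

  parity-degree-join : ∀ {A B} → IsJoin M (whole M) T A → IsJoin M (whole M) T B →
                       ∀ v → parity (degree (lookup A) v) ≡ parity (degree (lookup B) v)
  parity-degree-join jA jB v = ≡true⇔⇒≡ (⇔-sym (odd⇔∈T jB v) ⇔-∘ odd⇔∈T jA v)

  parity⇒join : ∀ A → (∀ v → parity (degree (lookup A) v) ≡ parity (degree (lookup F) v)) → IsJoin M (whole M) T A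
  parity⇒join A par = (λ _ → SubsetP.∈⊤) , λ v _ →
    odd⇔∈T (proj₁ minF) v ⇔-∘ (mk⇔ (trans (sym (par v))) (trans (par v)) ⇔-∘ odd⇔parityDegree A v)

  size-minJoin : ∀ {A} → IsJoin M (whole M) T A → size (lookup F) ≤ size (lookup A)
  size-minJoin {A} jA = subst₂ _≤_ (∣∣≡size F) (∣∣≡size A) (proj₂ minF A jA)

  -- F ⊕ E is again a join, so minimality gives |F| ≤ |F ⊕ E|.
  even-size∩≤ : ∀ E → Even E → size∩ F E ℕ.+ size∩ F E ≤ size E
  even-size∩≤ E even = ℕP.+-cancelˡ-≤ (size F′) _ _ (begin
    size F′ ℕ.+ (size∩ F E ℕ.+ size∩ F E)            ≡⟨ cong (λ k → size F′ ℕ.+ (k ℕ.+ k)) (size-∩ F′ E) ⟨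
    size F′ ℕ.+ (size (F′ ∩ᵇ E) ℕ.+ size (F′ ∩ᵇ E))  ≤⟨ ℕP.+-monoˡ-≤ _ F≤F⊕E ⟩
    size (F′ ⊕ᵇ E) ℕ.+ (size (F′ ∩ᵇ E) ℕ.+ size (F′ ∩ᵇ E)) ≡⟨ ∑∈-⊕ F′ E (λ _ → 1) ⟩
    size F′ ℕ.+ size E                              ∎)
    where
    open ℕP.≤-Reasoning
    F′ : Mask m
    F′ = lookup F
    F⊕E : Subset m
    F⊕E = Vec.tabulate (F′ ⊕ᵇ E)
    lookup-F⊕E : ∀ e → lookup F⊕E e ≡ (F′ ⊕ᵇ E) e
    lookup-F⊕E = VecP.lookup∘tabulate (F′ ⊕ᵇ E)
    F⊕E-join : IsJoin M (whole M) T F⊕E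
    F⊕E-join = parity⇒join F⊕E λ v →
      trans (cong parity (∑∈-cong (λ e → incidence e v) lookup-F⊕E)) (parity-degree-⊕-even F′ E even v)
    F≤F⊕E : size F′ ≤ size (F′ ⊕ᵇ E)
    F≤F⊕E = subst (size F′ ≤_) (∑∈-cong (λ _ → 1) lookup-F⊕E) (size-minJoin F⊕E-join)

  -1≤weight-path : ∀ {S a b e} (W : Walk M S a b) → IsPath M W → Joins M e a b → -[1+ 0 ] ℤ.≤ weight M F W
  -1≤weight-path {e = e} W p j =
    subst (-[1+ 0 ] ℤ.≤_) (sym (weight-path F W p)) (-k≤⊖ 1 (2o≤N+1 (P e) refl))
    where
    P C : Mask m
    P = edgeMask W
    C = P ⊕ᵇ ⁅ e ⁆ᵇ
    C-even : Even C
    C-even = OddExactlyAt-close {edgeMask W} (parity-degree-path W p) j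
    i : ℕ
    i = 𝟙 (lookup F e)
    2o≤N+1 : ∀ b → P e ≡ b → size∩ F P ℕ.+ size∩ F P ≤ size P ℕ.+ 1
    2o≤N+1 false Pe = begin
      o ℕ.+ o                     ≤⟨ ℕP.+-mono-≤ (ℕP.m≤n+m o i) (ℕP.m≤n+m o i) ⟩
      (i ℕ.+ o) ℕ.+ (i ℕ.+ o)     ≡⟨ cong (λ k → k ℕ.+ k) (∑∈-toggle-∉ P e (𝟙 ∘ lookup F) Pe) ⟨
      size∩ F C ℕ.+ size∩ F C     ≤⟨ even-size∩≤ C C-even ⟩
      size C                      ≡⟨ ∑∈-toggle-∉ P e (λ _ → 1) Pe ⟩
      1 ℕ.+ size P                ≡⟨ ℕP.+-comm 1 (size P) ⟩
      size P ℕ.+ 1                ∎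
      where
      open ℕP.≤-Reasoning
      o : ℕ
      o = size∩ F P
    2o≤N+1 true Pe = begin
      o ℕ.+ o                         ≡⟨ cong (λ k → k ℕ.+ k) (∑∈-toggle-∈ P e (𝟙 ∘ lookup F) Pe) ⟩
      (i ℕ.+ oC) ℕ.+ (i ℕ.+ oC)       ≤⟨ ℕP.+-mono-≤ (ℕP.+-monoˡ-≤ oC (𝟙≤1 (lookup F e))) (ℕP.+-monoˡ-≤ oC (𝟙≤1 (lookup F e))) ⟩
      suc oC ℕ.+ suc oC               ≡⟨ cong suc (ℕP.+-suc oC oC) ⟩
      2 ℕ.+ (oC ℕ.+ oC)               ≤⟨ ℕP.+-monoʳ-≤ 2 (even-size∩≤ C C-even) ⟩
      2 ℕ.+ size C                    ≡⟨ ℕP.+-comm 1 (suc (size C)) ⟩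
      (1 ℕ.+ size C) ℕ.+ 1            ≡⟨ cong (ℕ._+ 1) (∑∈-toggle-∈ P e (λ _ → 1) Pe) ⟨
      size P ℕ.+ 1                    ∎
      where
      open ℕP.≤-Reasoning
      o oC : ℕ
      o = size∩ F P
      oC = size∩ F C

  size-otherMinJoin : ∀ {F₂} → IsMinJoin M (whole M) T F₂ → size (lookup F) ≡ size (lookup F₂)
  size-otherMinJoin {F₂} minF₂ = ℕP.≤-antisym (size-minJoin (proj₁ minF₂))
    (subst₂ _≤_ (∣∣≡size F₂) (∣∣≡size F) (proj₂ minF₂ F (proj₁ minF)))

  ⊕-join-even : ∀ {F₂} → IsJoin M (whole M) T F₂ → Even (lookup F ⊕ᵇ lookup F₂)
  ⊕-join-even {F₂} join₂ v = trans (parity-degree-⊕ (lookup F) (lookup F₂) v)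
    (trans (cong (parity (degree (lookup F) v) xor_) (parity-degree-join join₂ (proj₁ minF) v))
           (BoolP.xor-same (parity (degree (lookup F) v))))

  -- F ⊕ F₂ is even with exactly half of its edges in F; without e it splits into a u–c path R
  -- and an even rest, which has at most half of its edges in F, so R has more than half.
  negativePath-otherMinJoin : ∀ {F₂ e u c} → IsMinJoin M (whole M) T F₂ →
    lookup F₂ e ≡ true → lookup F e ≡ false → Joins M e u c → u ≢ c →
    Σ[ R ∈ Walk M (whole M) u c ] IsPath M R × weight M F R ℤ.< + 0
  negativePath-otherMinJoin {F₂} {e} {u} {c} minF₂ F₂e Fe j u≢c =
    R , R-path , subst (ℤ._< + 0) (sym (weight-path F R R-path)) (⊖<0 |R|<2|R∩F|)
    where
    D : Mask m
    D = lookup F ⊕ᵇ lookup F₂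
    De : D e ≡ true
    De rewrite Fe | F₂e = refl
    D−e : Mask m
    D−e = D ⊕ᵇ ⁅ e ⁆ᵇ
    D−e-odd : OddExactlyAt D−e u c
    D−e-odd = Even-toggle {D} (⊕-join-even {F₂} (proj₁ minF₂)) j
    within : PathWithin D−e u c
    within = pathWithin D−e u≢c D−e-odd
    R : Walk M (whole M) u c
    R = proj₁ within
    R-path : IsPath M R
    R-path = proj₁ (proj₂ within)
    P K : Mask m
    P = edgeMask R
    K = D−e ∖ᵇ P
    1+|D−e|≡2|D−e∩F| : suc (size D−e) ≡ size∩ F D−e ℕ.+ size∩ F D−e
    1+|D−e|≡2|D−e∩F| = begin
      suc (size D−e)                ≡⟨ ∑∈-toggle-∈ D e (λ _ → 1) De ⟨
      size D                        ≡⟨ size-⊕-balanced (lookup F) (lookup F₂) (size-otherMinJoin minF₂) ⟩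
      size∩ F D ℕ.+ size∩ F D       ≡⟨ cong (λ k → k ℕ.+ k) (∑∈-toggle-∈ D e (𝟙 ∘ lookup F) De) ⟩
      (𝟙 (lookup F e) ℕ.+ size∩ F D−e) ℕ.+ (𝟙 (lookup F e) ℕ.+ size∩ F D−e)
                                    ≡⟨ cong (λ b → (𝟙 b ℕ.+ size∩ F D−e) ℕ.+ (𝟙 b ℕ.+ size∩ F D−e)) Fe ⟩
      size∩ F D−e ℕ.+ size∩ F D−e   ∎
      where open ≡-Reasoning
    |R|<2|R∩F| : size P < size∩ F P ℕ.+ size∩ F P
    |R|<2|R∩F| = odd-excess-inherited {k = size K} {size P} {fk = size∩ F K} {size∩ F P} 1+|D−e|≡2|D−e∩F|
                   (∑∈-⊆ D−e P (λ _ → 1) (edgeMask⊆ within)) (∑∈-⊆ D−e P (𝟙 ∘ lookup F) (edgeMask⊆ within))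
                   (even-size∩≤ K (OddExactlyAt-∖path {D−e} D−e-odd within))

module PathMinima {n m : ℕ} (M : Multigraph n m) {S : SubG M} (F : Subset m) where
  open Walks M
  open PathEdges M

  weight-spread : ∀ {x y x′ y′} (W : Walk M S x y) (W′ : Walk M S x′ y′) → IsPath M W → IsPath M W′ →
                  weight M F W ℤ.≤ weight M F W′ ℤ.+ + (m ℕ.+ m)
  weight-spread W W′ p p′ = begin
    weight M F W                          ≤⟨ weight-path-≤ F W p ⟩
    + m                                   ≡⟨ ℤP.+-identityˡ (+ m) ⟨
    + 0 ℤ.+ + m                           ≡⟨ cong (ℤ._+ + m) (ℤP.+-inverseˡ (+ m)) ⟨
    (ℤ.- + m ℤ.+ + m) ℤ.+ + m             ≡⟨ ℤP.+-assoc (ℤ.- + m) (+ m) (+ m) ⟩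
    ℤ.- + m ℤ.+ + (m ℕ.+ m)               ≤⟨ ℤP.+-monoˡ-≤ (+ (m ℕ.+ m)) (-m≤weight-path F W′ p′) ⟩
    weight M F W′ ℤ.+ + (m ℕ.+ m)         ∎
    where open ℤP.≤-Reasoning

  PathOfWeight : Fin n → Fin n → ℤ → Set
  PathOfWeight x y k = Σ[ W ∈ Walk M S x y ] IsPath M W × weight M F W ≡ k

  Lam-attained : ∀ {x y} (W : Walk M S x y) → IsPath M W →
                 ¬ ¬ (Σ[ k ∈ ℤ ] Lam M S F x y (fin k) × k ℤ.≤ weight M F W)
  Lam-attained {x} {y} W p ¬lam = ¬¬minimum (PathOfWeight x y) (m ℕ.+ m) (W , p , refl)
    (λ { k (W′ , p′ , refl) → weight-spread W W′ p p′ })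
    (λ { (k , ((W₀ , p₀ , w₀) , min) , k≤w) →
           ¬lam (k , ((W₀ , p₀ , w₀) , λ W′ p′ → min (weight M F W′) (W′ , p′ , refl)) , k≤w) })

  MinLam-attained : ∀ {X x y} → x ∈ X → (W : Walk M S x y) → IsPath M W →
                    ¬ ¬ (Σ[ k ∈ ℤ ] MinLam M S F X y (fin k) × k ℤ.≤ weight M F W)
  MinLam-attained {X} {x} {y} x∈X W p ¬min = ¬¬minimum PathFromX (m ℕ.+ m) (x , x∈X , W , p , refl)
    (λ { k (_ , _ , W′ , p′ , refl) → weight-spread W W′ p p′ })
    (λ { (k , ((x₀ , x₀∈X , W₀ , p₀ , w₀) , min) , k≤w) → ¬min (k , (
           (x₀ , x₀∈X , (W₀ , p₀ , w₀) , λ W′ p′ → min (weight M F W′) (x₀ , x₀∈X , W′ , p′ , refl)) ,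
           λ { x′ (fin k′) x′∈X ((W′ , p′ , refl) , _) → fin≤fin (min k′ (x′ , x′∈X , W′ , p′ , refl))
             ; x′ ∞ _ _ → fin k ≤∞∞ }) , k≤w) })
    where
    PathFromX : ℤ → Set
    PathFromX k = Σ[ x′ ∈ Fin n ] x′ ∈ X × PathOfWeight x′ y k

  Lam≥0⇒weight≥0 : ∀ {x y} → (∀ k → Lam M S F x y k → fin (+ 0) ≤∞ k) →
                   (W : Walk M S x y) → IsPath M W → + 0 ℤ.≤ weight M F W
  Lam≥0⇒weight≥0 λ≥0 W p = decidable-stable (+ 0 ℤ.≤? weight M F W) λ w≱0 →
    Lam-attained W p λ { (k , lam , k≤w) → w≱0 (ℤP.≤-trans (fin≤fin⁻¹ (λ≥0 (fin k) lam)) k≤w) }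

  MinLam⇒≤weight : ∀ {X x y k} → MinLam M S F X y (fin k) → x ∈ X → (W : Walk M S x y) → IsPath M W →
                   k ℤ.≤ weight M F W
  MinLam⇒≤weight {k = k} (_ , min) x∈X W p = decidable-stable (k ℤ.≤? weight M F W) λ k≰w →
    Lam-attained W p λ { (k′ , lam , k′≤w) → k≰w (ℤP.≤-trans (fin≤fin⁻¹ (min _ (fin k′) x∈X lam)) k′≤w) }

  weights≥0⇒Lam≥0 : ∀ {x y} → ((W : Walk M S x y) → IsPath M W → + 0 ℤ.≤ weight M F W) →
                    ∀ k → Lam M S F x y k → fin (+ 0) ≤∞ k
  weights≥0⇒Lam≥0 w≥0 (fin k) ((W , p , refl) , _) = fin≤fin (w≥0 W p)
  weights≥0⇒Lam≥0 w≥0 ∞ _ = fin (+ 0) ≤∞∞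

  minimalPath⇒MinLam : ∀ {X x y} → x ∈ X → (P : Walk M S x y) → IsPath M P →
    (∀ {x′} → x′ ∈ X → (Q : Walk M S x′ y) → IsPath M Q → weight M F P ℤ.≤ weight M F Q) →
    MinLam M S F X y (fin (weight M F P))
  minimalPath⇒MinLam x∈X P p minimal =
    (_ , x∈X , (P , p , refl) , λ Q q → minimal x∈X Q q) ,
    λ { x′ (fin k) x′∈X ((Q , q , refl) , _) → fin≤fin (minimal x′∈X Q q)
      ; x′ ∞ _ _ → fin (weight M F P) ≤∞∞ }

  MinLam-unique : ∀ {X y k₁ k₂} → MinLam M S F X y k₁ → MinLam M S F X y k₂ → k₁ ≡ k₂
  MinLam-unique ((x₁ , x₁∈X , lam₁) , min₁) ((x₂ , x₂∈X , lam₂) , min₂) =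
    ≤∞-antisym (min₁ x₂ _ x₂∈X lam₂) (min₂ x₁ _ x₁∈X lam₁)

  ⁅⁆-extreme : ∀ {y} → y ∈ V S → Extreme M S F ⁅ y ⁆
  ⁅⁆-extreme {y} y∈V = (λ u∈ → subst (_∈ V S) (sym (SubsetP.x∈⁅y⁆⇒x≡y y u∈)) y∈V) ,
    λ u v k u∈ v∈ → weights≥0⇒Lam≥0 (closed (SubsetP.x∈⁅y⁆⇒x≡y y u∈) (SubsetP.x∈⁅y⁆⇒x≡y y v∈)) k
    where
    closed : ∀ {u v} → u ≡ y → v ≡ y → (W : Walk M S u v) → IsPath M W → + 0 ℤ.≤ weight M F W
    closed refl refl W p rewrite closedPath-nil W p = ℤP.≤-refl

module ExtremeSets {n m : ℕ} (M : Multigraph n m) (col : Fin n → Bool) (bip : Bipartite M col (whole M))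
                   (T : Subset n) (F : Subset m) (minF : IsMinJoin M (whole M) T F)
                   (X : Subset n) (X⊆A : InClass M col (whole M) true X)
                   (maxX : MaxBipExtreme M col (whole M) F X) where
  open Walks M
  open BipartiteWalks M col bip
  open MinimumJoins M T F minF
  open PathMinima M {whole M} F
  open import Data.List.Membership.DecPropositional (_≟_ {n}) using () renaming (_∈?_ to _∈ᵥ?_)

  Path : Fin n → Fin n → Set
  Path = Walk M (whole M)

  InCX InDX : Fin n → Set
  InCX = InC M (whole M) F X
  InDX = InD M (whole M) F X

  colour-X : ∀ {x} → x ∈ X → col x ≡ true
  colour-X x∈X = proj₂ (X⊆A _ x∈X)

  weight-X→X≥0 : ∀ {x y} → x ∈ X → y ∈ X → (W : Path x y) → IsPath M W → + 0 ℤ.≤ weight M F W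
  weight-X→X≥0 x∈X y∈X = Lam≥0⇒weight≥0 (λ k → proj₂ (proj₁ (proj₁ maxX)) _ _ k x∈X y∈X)

  weight-X→C≥0 : ∀ {x c} → InCX c → x ∈ X → (W : Path x c) → IsPath M W → + 0 ℤ.≤ weight M F W
  weight-X→C≥0 (_ , c∉X , c∉D) x∈X W p = decidable-stable (+ 0 ℤ.≤? weight M F W) λ w≱0 →
    MinLam-attained x∈X W p λ (k , min , k≤w) →
      c∉D (SubsetP.∈⊤ , c∉X , fin k , min , fin<fin (ℤP.≤-<-trans k≤w (ℤP.≰⇒> w≱0)))

  weight-C→X≥0 : ∀ {x c} → InCX c → x ∈ X → (W : Path c x) → IsPath M W → + 0 ℤ.≤ weight M F W
  weight-C→X≥0 c∈C x∈X W p = subst (+ 0 ℤ.≤_) (weight-rev F W) (weight-X→C≥0 c∈C x∈X (rev W) (rev-isPath W p))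

  NegativeFromX : Fin n → Set
  NegativeFromX y = Σ[ x ∈ Fin n ] x ∈ X × Σ[ W ∈ Path x y ] IsPath M W × weight M F W ℤ.< + 0

  extend-extreme : ∀ {y} → col y ≡ true → ¬ NegativeFromX y → BipExtreme M col (whole M) F (X ∪ ⁅ y ⁆)
  extend-extreme {y} col-y ¬neg =
    ((λ _ → SubsetP.∈⊤) , λ u v k u∈ v∈ → weights≥0⇒Lam≥0 (weight≥0 (∈X∪y u∈) (∈X∪y v∈)) k) ,
    inj₁ (λ v v∈ → SubsetP.∈⊤ , Sum.[ colour-X , (λ { refl → col-y }) ] (∈X∪y v∈))
    where
    ∈X∪y : ∀ {u} → u ∈ X ∪ ⁅ y ⁆ → u ∈ X ⊎ u ≡ y
    ∈X∪y {u} u∈ = Sum.map₂ (SubsetP.x∈⁅y⁆⇒x≡y y) (SubsetP.x∈p∪q⁻ X ⁅ y ⁆ u∈)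
    weight-X→y≥0 : ∀ {x} → x ∈ X → (W : Path x y) → IsPath M W → + 0 ℤ.≤ weight M F W
    weight-X→y≥0 x∈X W p = ℤP.≮⇒≥ (λ w<0 → ¬neg (_ , x∈X , W , p , w<0))
    weight≥0 : ∀ {u v} → u ∈ X ⊎ u ≡ y → v ∈ X ⊎ v ≡ y → (W : Path u v) → IsPath M W → + 0 ℤ.≤ weight M F W
    weight≥0 (inj₁ u∈X) (inj₁ v∈X) W p = weight-X→X≥0 u∈X v∈X W p
    weight≥0 (inj₁ u∈X) (inj₂ refl) W p = weight-X→y≥0 u∈X W p
    weight≥0 (inj₂ refl) (inj₁ v∈X) W p = subst (+ 0 ℤ.≤_) (weight-rev F W) (weight-X→y≥0 v∈X (rev W) (rev-isPath W p))
    weight≥0 (inj₂ refl) (inj₂ refl) W p rewrite closedPath-nil W p = ℤP.≤-refl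

  ¬¬negativeFromX : ∀ {y} → col y ≡ true → y ∉ X → ¬ ¬ NegativeFromX y
  ¬¬negativeFromX {y} col-y y∉X ¬neg =
    y∉X (proj₂ maxX (X ∪ ⁅ y ⁆) (extend-extreme col-y ¬neg) (SubsetP.p⊆p∪q ⁅ y ⁆) (SubsetP.q⊆p∪q X ⁅ y ⁆ (SubsetP.x∈⁅x⁆ y)))

  colour-C : ∀ {c} → InCX c → col c ≡ false
  colour-C {c} c∈C = BoolP.¬-not λ col-c → ¬¬negativeFromX col-c (proj₁ (proj₂ c∈C))
    λ (x , x∈X , W , p , w<0) → ℤP.<⇒≱ w<0 (weight-X→C≥0 c∈C x∈X W p)

  colour-X≢colour-C : ∀ {x c} → x ∈ X → InCX c → col x ≢ col c
  colour-X≢colour-C x∈X c∈C col≡ = case trans (sym (colour-X x∈X)) (trans col≡ (colour-C c∈C)) of λ ()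

  -- If u ∉ X, maximality gives a negative path from X to u, of even weight and so ≤ −2. If it
  -- avoids c, prefixing e gives a negative path from c to X; otherwise its part from c to u
  -- closes a cycle with e and has weight < −1.
  C-neighbour∈X : ∀ {c u e} → InCX c → Joins M e c u → u ∈ X
  C-neighbour∈X {c} {u} {e} c∈C j = decidable-stable (u SubsetP.∈? X) λ u∉X →
    ¬¬negativeFromX col-u u∉X λ (x , x∈X , Q , q , w<0) → no-negative-path x∈X Q q w<0
    where
    col-u : col u ≡ true
    col-u = BoolP.¬-not λ col-u≡false → Joins⇒colour≢ j (trans (colour-C c∈C) (sym col-u≡false))
    no-negative-path : ∀ {x} → x ∈ X → (Q : Path x u) → IsPath M Q → weight M F Q ℤ.< + 0 → ⊥
    no-negative-path {x} x∈X Q q w<0 = case c ∈ᵥ? verts M Q of λ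
      { (yes c∈Q) → through-c c∈Q
      ; (no c∉Q) → avoiding-c c∉Q }
      where
      w<-1 : weight M F Q ℤ.< -[1+ 0 ]
      w<-1 = ℤP.≤∧≢⇒< (ℤP.i<j⇒i≤pred[j] w<0) (weight-path-≢-1 F Q q (trans (colour-X x∈X) (sym col-u)))
      through-c : c ∈ₗ verts M Q → ⊥
      through-c c∈Q = ℤP.<⇒≱ suffix<-1 (-1≤weight-path suffix suffix-isPath j)
        where
        open Split (split Q q c∈Q)
        suffix<-1 : weight M F suffix ℤ.< -[1+ 0 ]
        suffix<-1 = ℤP.≤-<-trans (subst (weight M F suffix ℤ.≤_) (sym (weight-split F))
                      (≤-+-nonneg (weight-X→C≥0 c∈C x∈X prefix prefix-isPath))) w<-1
      avoiding-c : c ∉ₗ verts M Q → ⊥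
      avoiding-c c∉Q = ℤP.<⇒≱ R<0 (weight-C→X≥0 c∈C x∈X R R-path)
        where
        R : Path c x
        R = cons e SubsetP.∈⊤ j (rev Q)
        R-path : IsPath M R
        R-path = SubsetP.∈⊤ ∷ proj₁ (rev-isPath Q q) ,
                 AllP.¬Any⇒All¬ _ (c∉Q ∘ rev-verts⊆ Q) ∷ proj₂ (rev-isPath Q q)
        R<0 : weight M F R ℤ.< + 0
        R<0 = subst (ℤ._< + 0) (cong (λ w → edgeWeight F e ℤ.+ w) (sym (weight-rev F Q)))
                (ℤP.+-mono-≤-< (edgeWeight≤1 F e) w<-1)

  C-edge∉F : ∀ {c u e} → InCX c → Joins M e c u → lookup F e ≡ false
  C-edge∉F {e = e} c∈C j = BoolP.¬-not λ Fe →
    ℤP.<⇒≱ (e<0 Fe) (weight-X→C≥0 c∈C (C-neighbour∈X c∈C j) (edge (Joins-sym j)) (edge-isPath (Joins-sym j) (Joins⇒≢ j ∘ sym)))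
    where
    e<0 : lookup F e ≡ true → weight M F (edge (Joins-sym j)) ℤ.< + 0
    e<0 Fe rewrite Fe = ℤ.-<+

  C∉T : ∀ {c} → InCX c → c ∉ T
  C∉T {c} c∈C c∈T with odd⇒incidentEdge (lookup F) c (Equivalence.from (odd⇔∈T (proj₁ minF) c) c∈T)
  ... | e , Fe , _ , j = case trans (sym Fe) (C-edge∉F c∈C j) of λ ()

  C-edge∉minJoin : ∀ {F₂} → IsMinJoin M (whole M) T F₂ → ∀ {c u e} → InCX c → Joins M e c u → lookup F₂ e ≡ false
  C-edge∉minJoin minF₂ c∈C j = BoolP.¬-not λ F₂e →
    let R , R-path , R<0 = negativePath-otherMinJoin minF₂ F₂e (C-edge∉F c∈C j) (Joins-sym j) (Joins⇒≢ j ∘ sym)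
    in ℤP.<⇒≱ R<0 (weight-X→C≥0 c∈C (C-neighbour∈X c∈C j) R R-path)

module Deletion {n m : ℕ} (M : Multigraph n m) (C′ : Subset n) where
  open Walks M

  G′ : SubG M
  G′ = delete M (whole M) C′

  ∈V-delete : ∀ {v} → v ∉ C′ → v ∈ V G′
  ∈V-delete = SubsetP.x∈p∧x∉q⇒x∈p─q SubsetP.∈⊤

  V-delete⁻ : ∀ {v} → v ∈ V G′ → v ∉ C′
  V-delete⁻ = x∈p─q⇒x∉q ⊤ C′

  lookup-E-delete : ∀ e → lookup (E G′) e ≡ not (lookup C′ (end₁ e)) ∧ not (lookup C′ (end₂ e))
  lookup-E-delete e = trans (VecP.lookup∘tabulate _ e) (cong (_∧ _) (VecP.lookup-replicate e true))

  ∈E-delete : ∀ {e} → end₁ e ∉ C′ → end₂ e ∉ C′ → e ∈ E G′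
  ∈E-delete {e} e₁∉ e₂∉ = VecP.lookup⇒[]= e (E G′)
    (trans (lookup-E-delete e) (cong₂ (λ a b → not a ∧ not b) (∉⇒lookup≡false e₁∉) (∉⇒lookup≡false e₂∉)))

  E-delete⁻ : ∀ {e} → e ∈ E G′ → end₁ e ∉ C′ × end₂ e ∉ C′
  E-delete⁻ {e} e∈ with lookup C′ (end₁ e) in e₁ | lookup C′ (end₂ e) in e₂
                       | trans (sym (lookup-E-delete e)) (VecP.[]=⇒lookup e∈)
  ... | false | false | _ = lookup≡false⇒∉ e₁ , lookup≡false⇒∉ e₂
  ... | true | _ | ()
  ... | false | true | ()

  restrict : ∀ {x y} (W : Walk M (whole M) x y) → All (_∉ C′) (verts M W) → Walk M G′ x y
  restrict W avoid = transport W (All.tabulate λ e∈ →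
    ∈E-delete (All.lookup avoid (proj₁ (ends∈verts W e∈))) (All.lookup avoid (proj₂ (ends∈verts W e∈))))

  restrict-isPath : ∀ {x y} (W : Walk M (whole M) x y) avoid → IsPath M W → IsPath M (restrict W avoid)
  restrict-isPath W avoid = transport-isPath W _ (All.map ∈V-delete avoid)

  weight-restrict : ∀ {x y} F (W : Walk M (whole M) x y) avoid → weight M F (restrict W avoid) ≡ weight M F W
  weight-restrict F W avoid = weight-transport F W _

  module _ (T : Subset n) (C′∩T=∅ : ∀ {v} → v ∈ C′ → v ∉ T) where

    degree-at-deleted : ∀ (J : Subset m) → (∀ {e} → e ∈ J → e ∈ E G′) → ∀ {v} → v ∈ C′ → deg M J v ≡ 0
    degree-at-deleted J J⊆E′ {v} v∈C′ = trans (deg≡degree J v)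
      (∑∈-zero (lookup J) (λ e → incidence e v) (λ e Je → avoids (E-delete⁻ (J⊆E′ (VecP.lookup⇒[]= e J Je)))))
      where
      avoids : ∀ {e} → end₁ e ∉ C′ × end₂ e ∉ C′ → incidence e v ≡ 0
      avoids {e} (e₁∉ , e₂∉) = cong₂ ℕ._+_ (cong 𝟙 (dec-false (end₁ e ≟ v) λ { refl → e₁∉ v∈C′ }))
                                           (cong 𝟙 (dec-false (end₂ e ≟ v) λ { refl → e₂∉ v∈C′ }))

    ∈T─C′⇔∈T : ∀ {v} → v ∉ C′ → v ∈ T ─ C′ ⇔ v ∈ T
    ∈T─C′⇔∈T v∉C′ = mk⇔ (SubsetP.p─q⊆p T C′) (λ v∈T → SubsetP.x∈p∧x∉q⇒x∈p─q v∈T v∉C′)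

    join-delete⇒join : ∀ {J} → IsJoin M G′ (T ─ C′) J → IsJoin M (whole M) T J
    join-delete⇒join {J} (J⊆E′ , odd⇔) = (λ _ → SubsetP.∈⊤) , λ v _ → at v (v SubsetP.∈? C′)
      where
      at : ∀ v → Dec (v ∈ C′) → (deg M J v % 2 ≡ 1) ⇔ v ∈ T
      at v (yes v∈C′) = mk⇔ (λ odd → case trans (sym odd) (cong (_% 2) (degree-at-deleted J J⊆E′ v∈C′)) of λ ())
                            (λ v∈T → ⊥-elim (C′∩T=∅ v∈C′ v∈T))
      at v (no v∉C′) = ∈T─C′⇔∈T v∉C′ ⇔-∘ odd⇔ v (∈V-delete v∉C′)

    join⇒join-delete : ∀ {J} → IsJoin M (whole M) T J → (∀ {e} → e ∈ J → e ∈ E G′) → IsJoin M G′ (T ─ C′) J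
    join⇒join-delete {J} (_ , odd⇔) J⊆E′ = J⊆E′ , λ v v∈V′ →
      ⇔-sym (∈T─C′⇔∈T (V-delete⁻ v∈V′)) ⇔-∘ odd⇔ v SubsetP.∈⊤

module DeletingPartOfC {n m : ℕ} (M : Multigraph n m) (col : Fin n → Bool) (bip : Bipartite M col (whole M))
                       (T : Subset n) (F : Subset m) (minF : IsMinJoin M (whole M) T F)
                       (X : Subset n) (X⊆A : InClass M col (whole M) true X)
                       (maxX : MaxBipExtreme M col (whole M) F X)
                       (C′ : Subset n) (C′⊆C : ∀ v → v ∈ C′ → InC M (whole M) F X v) where
  open Walks M
  open BipartiteWalks M col bip
  open PathMinima M {whole M} F
  module PathMinima′ = PathMinima M {delete M (whole M) C′} F
  open ExtremeSets M col bip T F minF X X⊆A maxX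
  open Deletion M C′

  X∩C′=∅ : ∀ {x} → x ∈ X → x ∉ C′
  X∩C′=∅ x∈X x∈C′ = proj₁ (proj₂ (C′⊆C _ x∈C′)) x∈X

  D∩C′=∅ : ∀ {y} → InDX y → y ∉ C′
  D∩C′=∅ y∈D y∈C′ = proj₂ (proj₂ (C′⊆C _ y∈C′)) y∈D

  minJoin⊆E′ : ∀ {F₂} → IsMinJoin M (whole M) T F₂ → ∀ {e} → e ∈ F₂ → e ∈ E G′
  minJoin⊆E′ minF₂ {e} e∈F₂ = ∈E-delete (not-at (inj₁ refl)) (not-at (inj₂ refl))
    where
    not-at : ∀ {c u} → Joins M e c u → c ∉ C′
    not-at j c∈C′ = case trans (sym (VecP.[]=⇒lookup e∈F₂)) (C-edge∉minJoin minF₂ (C′⊆C _ c∈C′) j) of λ ()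

  -- P leaves a vertex of C_X through an edge outside F towards X, after a non-negative prefix,
  -- so the rest of P is a strictly lighter path from X.
  minimalPath-avoids : ∀ {x y} → x ∈ X → (P : Path x y) → IsPath M P → y ∉ C′ →
    (∀ {x′} → x′ ∈ X → (Q : Path x′ y) → IsPath M Q → weight M F P ℤ.≤ weight M F Q) → All (_∉ C′) (verts M P)
  minimalPath-avoids {y = y} x∈X P p y∉C′ minimal = All.tabulate λ {c} c∈P c∈C′ →
    leaves-C (C′⊆C _ c∈C′) (λ { refl → y∉C′ c∈C′ }) (split P p c∈P)
    where
    leaves-C : ∀ {c} → InCX c → c ≢ y → Split P c → ⊥
    leaves-C c∈C c≢y sp with Split.suffix sp | Split.suffix-isPath sp | Split.weight-split sp F
    ... | nil _ | _ | _ = c≢y refl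
    ... | cons e e∈ j Q | q | w≡ = ℤP.<⇒≱ Q<P (minimal (C-neighbour∈X c∈C j) Q (tail-isPath e e∈ j Q q))
      where
      open Split sp using (prefix; prefix-isPath)
      Q<P : weight M F Q ℤ.< weight M F P
      Q<P = ℤP.suc[i]≤j⇒i<j (begin
        ℤ.suc (weight M F Q)                                     ≡⟨ cong (λ b → (if b then -[1+ 0 ] else + 1) ℤ.+ weight M F Q) (C-edge∉F c∈C j) ⟨
        edgeWeight F e ℤ.+ weight M F Q                          ≤⟨ ≤-+-nonneg (weight-X→C≥0 c∈C x∈X prefix prefix-isPath) ⟩
        weight M F prefix ℤ.+ (edgeWeight F e ℤ.+ weight M F Q)  ≡⟨ w≡ ⟨
        weight M F P                                             ∎)
        where open ℤP.≤-Reasoning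

  minJoins-agree : ∀ F′ → IsMinJoin M G′ (T ─ C′) F′ ⇔ IsMinJoin M (whole M) T F′
  minJoins-agree F′ = mk⇔
    (λ (join′ , min′) → join-delete⇒join′ join′ ,
       λ J joinJ → ℕP.≤-trans (min′ F (join⇒join-delete′ (proj₁ minF) (minJoin⊆E′ minF))) (proj₂ minF J joinJ))
    (λ (join , min) → join⇒join-delete′ join (minJoin⊆E′ (join , min)) ,
       λ J joinJ′ → min J (join-delete⇒join′ joinJ′))
    where
    C′∩T=∅ : ∀ {v} → v ∈ C′ → v ∉ T
    C′∩T=∅ v∈C′ = C∉T (C′⊆C _ v∈C′)
    join-delete⇒join′ : ∀ {J} → IsJoin M G′ (T ─ C′) J → IsJoin M (whole M) T J
    join-delete⇒join′ = join-delete⇒join T C′∩T=∅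
    join⇒join-delete′ : ∀ {J} → IsJoin M (whole M) T J → (∀ {e} → e ∈ J → e ∈ E G′) → IsJoin M G′ (T ─ C′) J
    join⇒join-delete′ = join⇒join-delete T C′∩T=∅

  minLam-agree : ∀ y k → InDX y → MinLam M G′ F X y k ⇔ MinLam M (whole M) F X y k
  minLam-agree y k (_ , _ , ∞ , _ , (() , _))
  minLam-agree y k y∈D@(_ , _ , fin k₀ , min₀@((x₀ , x₀∈X , (P , p , refl) , _) , _) , _) = mk⇔
    (λ h → subst (MinLam M (whole M) F X y) (PathMinima′.MinLam-unique min′ h) min₀)
    (λ h → subst (MinLam M G′ F X y) (MinLam-unique min₀ h) min′)
    where
    minimal : ∀ {x′} → x′ ∈ X → (Q : Path x′ y) → IsPath M Q → weight M F P ℤ.≤ weight M F Q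
    minimal x′∈X Q q = MinLam⇒≤weight min₀ x′∈X Q q
    avoid : All (_∉ C′) (verts M P)
    avoid = minimalPath-avoids x₀∈X P p (D∩C′=∅ y∈D) minimal
    min′ : MinLam M G′ F X y (fin (weight M F P))
    min′ = subst (λ w → MinLam M G′ F X y (fin w)) (weight-restrict F P avoid)
      (PathMinima′.minimalPath⇒MinLam x₀∈X (restrict P avoid) (restrict-isPath P avoid p)
        λ x′∈X Q q → subst₂ ℤ._≤_ (sym (weight-restrict F P avoid)) (weight-embed F Q)
                       (minimal x′∈X (embed Q) (embed-isPath Q q)))

  lam-X→C∖C′>0 : ∀ x y k → x ∈ X → InCX y → y ∉ C′ → Lam M G′ F x y k → fin (+ 0) <∞ k
  lam-X→C∖C′>0 x y ∞ _ _ _ _ = fin (+ 0) ≤∞∞ , λ ()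
  lam-X→C∖C′>0 x y (fin k) x∈X y∈C _ ((Q , q , refl) , _) = fin<fin (subst (+ 0 ℤ.<_) (weight-embed F Q)
    (ℤP.≤∧≢⇒< (weight-X→C≥0 y∈C x∈X (embed Q) (embed-isPath Q q))
              (weight-path-≢0 F (embed Q) (embed-isPath Q q) (colour-X≢colour-C x∈X y∈C) ∘ sym)))

  lam-X→X≥0 : ∀ x y k → x ∈ X → y ∈ X → Lam M G′ F x y k → fin (+ 0) ≤∞ k
  lam-X→X≥0 x y k x∈X y∈X = PathMinima′.weights≥0⇒Lam≥0 (λ Q q →
    subst (+ 0 ℤ.≤_) (weight-embed F Q) (weight-X→X≥0 x∈X y∈X (embed Q) (embed-isPath Q q))) k

  maxBipExtreme-delete : MaxBipExtreme M col G′ F X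
  maxBipExtreme-delete =
    (((∈V-delete ∘ X∩C′=∅) , lam-X→X≥0) , inj₁ (λ v v∈X → ∈V-delete (X∩C′=∅ v∈X) , colour-X v∈X)) ,
    λ Y bipY X⊆Y {y} y∈Y → decidable-stable (y SubsetP.∈? X) λ y∉X → outside-X bipY X⊆Y y∈Y y∉X (col y) refl
    where
    outside-X : ∀ {Y y} → BipExtreme M col G′ F Y → X Sub.⊆ Y → y ∈ Y → y ∉ X → ∀ b → col y ≡ b → ⊥
    outside-X {Y} {y} ((_ , Y-extreme) , _) X⊆Y y∈Y y∉X true col-y =
      ¬¬negativeFromX col-y y∉X λ (x , x∈X , W , p , w<0) → MinLam-attained x∈X W p λ (k , min , k≤w) →
        let k<0 = ℤP.≤-<-trans k≤w w<0
            ((x′ , x′∈X , lam′) , _) = Equivalence.from (minLam-agree y (fin k) (SubsetP.∈⊤ , y∉X , fin k , min , fin<fin k<0)) min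
        in ℤP.<⇒≱ k<0 (fin≤fin⁻¹ (Y-extreme x′ y (fin k) (X⊆Y x′∈X) y∈Y lam′))
    outside-X (_ , inj₁ Y⊆A) X⊆Y y∈Y y∉X false col-y = case trans (sym col-y) (proj₂ (Y⊆A _ y∈Y)) of λ ()
    -- X ⊆ Y ⊆ B and X ⊆ A force X to be empty, so maximality of X against ⁅ y ⁆ gives y ∈ X.
    outside-X (_ , inj₂ Y⊆B) X⊆Y y∈Y y∉X false col-y =
      y∉X (proj₂ maxX ⁅ _ ⁆ (⁅⁆-extreme SubsetP.∈⊤ , inj₂ (λ v v∈ → SubsetP.∈⊤ , trans (cong col (SubsetP.x∈⁅y⁆⇒x≡y _ v∈)) col-y))
                     (λ x∈X → ⊥-elim (case trans (sym (colour-X x∈X)) (proj₂ (Y⊆B _ (X⊆Y x∈X))) of λ ()))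
                     (SubsetP.x∈⁅x⁆ _))

lemma6p4 : {n m : ℕ} (M : Multigraph n m) (col : Fin n → Bool)
    → Bipartite M col (whole M)
    → (T : Subset n) (F : Subset m)
    → IsMinJoin M (whole M) T F
    → (X : Subset n)
    → InClass M col (whole M) true X
    → MaxBipExtreme M col (whole M) F X
    → (C′ : Subset n)
    → (∀ v → v ∈ C′ → InC M (whole M) F X v)
    → ((∀ F′ → IsMinJoin M (delete M (whole M) C′) (T ─ C′) F′ ⇔ IsMinJoin M (whole M) T F′)
      × (∀ y k → InD M (whole M) F X y
           → MinLam M (delete M (whole M) C′) F X y k ⇔ MinLam M (whole M) F X y k)
      × (∀ x y k → x ∈ X → InC M (whole M) F X y → y ∉ C′
           → Lam M (delete M (whole M) C′) F x y k → fin (+ 0) <∞ k)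
      × (∀ x y k → x ∈ X → y ∈ X
           → Lam M (delete M (whole M) C′) F x y k → fin (+ 0) ≤∞ k)
      × MaxBipExtreme M col (delete M (whole M) C′) F X)
lemma6p4 M col bip T F minF X X⊆A maxX C′ C′⊆C =
  minJoins-agree , minLam-agree , lam-X→C∖C′>0 , lam-X→X≥0 , maxBipExtreme-delete
  where open DeletingPartOfC M col bip T F minF X X⊆A maxX C′ C′⊆C
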